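{- Let $\mathcal{K}(x,y)=\sum_{n\geq 0}\sum_{r=0}^{n}k(r,n)\frac{x^r y^{n-r}}{r!\,(n-r)!}$. Then \[\mathcal{K}(x,y)=\frac{\mathcal{L}(x,y)+1}{1-x-y+xy},\] where $\mathcal{L}(x,y)$ is the unique power series satisfying $\partial_x\partial_y\mathcal{L}(x,y)=e^{x+y}I_0(2\sqrt{xy})$ with boundary conditions $\mathcal{L}(x,0)=0$ and $\mathcal{L}(0,y)=0$.
   Context: Let $\mathfrak{S}_n$ be the group of permutations of $\{1,\dots,n\}$ in one-line notation. A permutation $w\in\mathfrak{S}_n$ contains the split pattern $3|12$ with respect to position $r$ if there are indices $i_1\leq r<i_2<i_3$ with $w(i_2)<w(i_3)<w(i_1)$; it contains $23|1$ with respect to position $r$ if there are indices $i_1<i_2\leq r<i_3$ with $w(i_3)<w(i_1)<w(i_2)$. Let $k(r,n)$ be the number of $w\in\mathfrak{S}_n$ avoiding both patterns with respect to position $r$, with $k(0,0)=1$. Here $I_0(z)=\sum_{m\geq 0}\frac{1}{(m!)^2}\left(\frac{z^2}{4}\right)^m$ is the modified Bessel function of the first kind of order $0$; note $I_0(2\sqrt{xy})=\sum_{m\ge0}\frac{(xy)^m}{(m!)^2}$ is a power series in $x,y$. Identities are as formal power series (equivalently, analytic functions near the origin). -}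

module Defs where

open import Data.Nat as ℕ using (ℕ; zero; suc; _!; _<ᵇ_; _≡ᵇ_)
open import Data.Nat.Properties using (_!≢0; _!*_!≢0)
open import Data.Bool.ListAction using (any)
open import Data.Fin using (Fin; toℕ)
open import Data.Vec using (Vec; []; _∷_; lookup)
open import Data.List using (List; []; _∷_; map; concatMap; upTo; allFin; foldr; length)
open import Data.Bool using (Bool; true; false; _∧_; if_then_else_; not)
open import Data.Integer using (+_)
open import Data.Rational using (ℚ; 0ℚ; 1ℚ; _+_; _*_; _-_; -_; _/_)
open import Relation.Binary.PropositionalEquality using (_≡_)
open import Data.Product using (_×_; Σ)

-- Permutations of {1..n} in one-line notation, as vectors w of length n
-- with entries in Fin n (position j, 0-based, holds the value w(j+1)-1).

vecsOver : {A : Set} → (m : ℕ) → List A → List (Vec A m)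
vecsOver zero    xs = [] ∷ []
vecsOver (suc m) xs = concatMap (λ x → map (x ∷_) (vecsOver m xs)) xs

anyFin : (n : ℕ) → (Fin n → Bool) → Bool
anyFin n p = any p (allFin n)

isPerm : {n : ℕ} → Vec (Fin n) n → Bool
isPerm {n} w = not (anyFin n λ i → anyFin n λ j →
  (toℕ i <ᵇ toℕ j) ∧ (toℕ (lookup w i) ≡ᵇ toℕ (lookup w j)))

_<F_ : {n : ℕ} → Fin n → Fin n → Bool
a <F b = toℕ a <ᵇ toℕ b

-- 1-based indices i1 ≤ r < i2 < i3 become 0-based j1 < r ≤ j2 < j3,
-- with w(i2) < w(i3) < w(i1).
contains3|12 : {n : ℕ} → ℕ → Vec (Fin n) n → Bool
contains3|12 {n} r w = anyFin n λ j1 → anyFin n λ j2 → anyFin n λ j3 →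
  (toℕ j1 <ᵇ r) ∧ not (toℕ j2 <ᵇ r) ∧ (j2 <F j3) ∧
  (lookup w j2 <F lookup w j3) ∧ (lookup w j3 <F lookup w j1)

-- 1-based indices i1 < i2 ≤ r < i3 become 0-based j1 < j2 < r ≤ j3,
-- with w(i3) < w(i1) < w(i2).
contains23|1 : {n : ℕ} → ℕ → Vec (Fin n) n → Bool
contains23|1 {n} r w = anyFin n λ j1 → anyFin n λ j2 → anyFin n λ j3 →
  (j1 <F j2) ∧ (toℕ j2 <ᵇ r) ∧ not (toℕ j3 <ᵇ r) ∧
  (lookup w j3 <F lookup w j1) ∧ (lookup w j1 <F lookup w j2)

countB : {A : Set} → (A → Bool) → List A → ℕ
countB p = foldr (λ x c → if p x then suc c else c) 0

k : ℕ → ℕ → ℕ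
k r n = countB (λ w → isPerm w ∧ not (contains3|12 r w) ∧ not (contains23|1 r w))
               (vecsOver n (allFin n))

-- Formal power series in x, y over ℚ: F a b = coefficient of x^a y^b.

PS : Set
PS = ℕ → ℕ → ℚ

_≈PS_ : PS → PS → Set
F ≈PS G = ∀ a b → F a b ≡ G a b

sumℚ : List ℚ → ℚ
sumℚ = foldr _+_ 0ℚ

_⊕_ : PS → PS → PS
(F ⊕ G) a b = F a b + G a b

_⊖_ : PS → PS → PS
(F ⊖ G) a b = F a b - G a b

_⊛_ : PS → PS → PS
(F ⊛ G) a b = sumℚ (map (λ i → sumℚ (map (λ j → F i j * G (a ℕ.∸ i) (b ℕ.∸ j))
                                        (upTo (suc b))))
                        (upTo (suc a)))

oneS : PS
oneS zero zero = 1ℚ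
oneS _    _    = 0ℚ

xS : PS
xS 1 zero = 1ℚ
xS _ _    = 0ℚ

yS : PS
yS zero 1 = 1ℚ
yS _ _    = 0ℚ

ℕtoℚ : ℕ → ℚ
ℕtoℚ m = (+ m) / 1

∂x : PS → PS
∂x F a b = ℕtoℚ (suc a) * F (suc a) b

∂y : PS → PS
∂y F a b = ℕtoℚ (suc b) * F a (suc b)

expXY : PS
expXY a b = (+ 1) / (a ! ℕ.* b !) where instance _ = _!*_!≢0 a b

-- I₀(2√(xy)) = Σ_m (xy)^m / (m!)^2
I0 : PS
I0 a b = if a ≡ᵇ b then (+ 1) / (a ! ℕ.* a !) else 0ℚ
  where instance _ = _!*_!≢0 a a

-- 𝒦(x,y) = Σ_n Σ_{r≤n} k(r,n) x^r y^(n-r) / (r! (n-r)!)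
-- coefficient of x^a y^b is k(a, a+b) / (a! b!)
𝒦 : PS
𝒦 a b = (+ k a (a ℕ.+ b)) / (a ! ℕ.* b !) where instance _ = _!*_!≢0 a b

denom : PS
denom = ((oneS ⊖ xS) ⊖ yS) ⊕ (xS ⊛ yS)

IsL : PS → Set
IsL L = (∂x (∂y L) ≈PS (expXY ⊛ I0)) × (∀ a → L a 0 ≡ 0ℚ) × (∀ b → L 0 b ≡ 0ℚ)

module Submission where

-- Write K(a,b) = k(a,a+b), so that the coefficient of x^a y^b in 𝒦 is K(a,b)/(a! b!).
-- Classify the counted permutations of {1,…,n+1} by where their extreme values sit. When the
-- minimum lies left of the boundary, deleting it leaves a counted permutation for the boundary
-- moved one step left; otherwise delete the maximum, which lies right of the boundary, or else is
-- the first entry, and then both blocks of what remains are decreasing. Since a permutation with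
-- both blocks decreasing is determined by the set of values in its first block, this gives
--   K(0,b+1) = (b+1) K(0,b),   K(a+1,0) = (a+1) K(a,0),
--   K(a+1,b+1) − (a+1) K(a,b+1) − (b+1) K(a+1,b) + (a+1)(b+1) K(a,b) = C(a+b,a).
-- Read through the coefficients, this says that 𝒦·(1−x)(1−y) has constant term 1, vanishes
-- elsewhere on the axes and has coefficient C(a+b,a)/((a+1)!(b+1)!) at x^(a+1) y^(b+1). By
-- Vandermonde's identity the coefficient of x^a y^b in e^(x+y) I₀(2√(xy)) is C(a+b,a)/(a! b!),
-- so these are exactly the coefficients of 𝓛 + 1.

open import Defs
open import Data.Product using (_×_; _,_; Σ; ∃; ∃₂; proj₁; proj₂; uncurry)
open import Function using (_∘_; _⇔_; mk⇔; Equivalence)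
open import Relation.Binary.PropositionalEquality using (_≡_; _≢_; refl; sym; trans; cong; cong₂; subst; subst₂; module ≡-Reasoning)

open Equivalence using (to; from)
open ≡-Reasoning

module Permutations where

  open import Data.Bool using (Bool; true; false; _∧_; _∨_; not)
  open import Data.Bool.ListAction using (any)
  open import Data.Fin using (Fin; zero; suc; toℕ; fromℕ; fromℕ<; punchIn; punchOut)
  open import Data.Fin.Properties
    using (any?; pigeonhole; toℕ-injective; toℕ<n; toℕ-fromℕ; toℕ-fromℕ<; ≤fromℕ;
           punchIn-injective; punchInᵢ≢i; punchIn-punchOut; punchOut-punchIn; punchOut-injective; punchIn-mono-≤; punchIn-cancel-≤)
    renaming (_≟_ to _≟ᶠ_)
  import Data.Fin.Properties as Fin
  open import Data.List using (List; []; _∷_; _++_; map; concatMap; allFin; cartesianProduct)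
  open import Data.List.Properties using (map-tabulate; map-++; map-∘)
  open import Data.Nat using (ℕ; zero; suc; _+_; _*_; _∸_; _<_; _≤_; _<ᵇ_; _<?_; _≤?_; _≟_; z≤n; s≤s; s≤s⁻¹; z<s)
  open import Data.Nat.Combinatorics using (_C_; nCk+nC[k+1]≡[n+1]C[k+1]; nCn≡1)
  open import Data.Nat.Properties
    using (+-suc; +-comm; +-identityʳ; *-zeroʳ; *-identityˡ; *-distribˡ-+; *-distribʳ-+; suc-injective;
           <-cmp; <-irrefl; <-trans; <-≤-trans; ≤-trans; ≤-reflexive; <⇒≤; <⇒≱; ≤⇒≯; ≮⇒≥; ≰⇒>; ≤∧≢⇒<;
           n<1+n; n≤1+n; n≮0; n≢0⇒n>0; m≤n⇒m≤1+n; m≤m+n; m+n∸m≡n)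
  open import Data.Nat.Solver using (module +-*-Solver)
  open import Data.Product.Function.NonDependent.Propositional using (_×-⇔_)
  import Data.Product.Properties as ×
  open import Data.Vec as Vec using (Vec; []; _∷_; lookup; insertAt; removeAt)
  import Data.Vec.Properties as Vecₚ
  open import Level using (Level)
  open import Relation.Binary.Definitions using (DecidableEquality; tri<; tri≈; tri>)
  open import Relation.Nullary using (Dec; yes; no; does; ¬_; ¬?; _×-dec_; contradiction)
  import Relation.Nullary.Decidable as Dec
  open import Relation.Nullary.Decidable using (does-⇔; dec-false)
  open import Relation.Unary using (Pred; Decidable)
  open import Relation.Unary.Properties using (_∩?_; ∁?)

  private
    variable
      ℓ ℓ′ ℓ″ : Level
      X Y : Set
      m n : ℕ

  𝟙 : Bool → ℕ
  𝟙 true  = 1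
  𝟙 false = 0

  ∑ : List X → (X → ℕ) → ℕ
  ∑ []       f = 0
  ∑ (x ∷ xs) f = f x + ∑ xs f

  ∑-cong : (xs : List X) {f g : X → ℕ} → (∀ x → f x ≡ g x) → ∑ xs f ≡ ∑ xs g
  ∑-cong []       f≗g = refl
  ∑-cong (x ∷ xs) f≗g = cong₂ _+_ (f≗g x) (∑-cong xs f≗g)

  ∑-zero : (xs : List X) {f : X → ℕ} → (∀ x → f x ≡ 0) → ∑ xs f ≡ 0
  ∑-zero []       f≗0 = refl
  ∑-zero (x ∷ xs) f≗0 = cong₂ _+_ (f≗0 x) (∑-zero xs f≗0)

  ∑-+ : (xs : List X) (f g : X → ℕ) → ∑ xs (λ x → f x + g x) ≡ ∑ xs f + ∑ xs g
  ∑-+ []       f g = refl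
  ∑-+ (x ∷ xs) f g = begin
    f x + g x + ∑ xs (λ x → f x + g x) ≡⟨ cong (f x + g x +_) (∑-+ xs f g) ⟩
    f x + g x + (∑ xs f + ∑ xs g)      ≡⟨ solve 4 (λ a b c d → a :+ b :+ (c :+ d) := a :+ c :+ (b :+ d)) refl (f x) (g x) (∑ xs f) (∑ xs g) ⟩
    f x + ∑ xs f + (g x + ∑ xs g)      ∎
    where open +-*-Solver

  ∑-swap : (xs : List X) (ys : List Y) (f : X → Y → ℕ) →
           ∑ xs (λ x → ∑ ys (f x)) ≡ ∑ ys (λ y → ∑ xs (λ x → f x y))
  ∑-swap []       ys f = sym (∑-zero ys (λ _ → refl))
  ∑-swap (x ∷ xs) ys f = trans (cong (∑ ys (f x) +_) (∑-swap xs ys f)) (sym (∑-+ ys (f x) _))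

  countB-cong : {p q : X → Bool} → (∀ x → p x ≡ q x) → (xs : List X) → countB p xs ≡ countB q xs
  countB-cong p≗q []       = refl
  countB-cong {q = q} p≗q (x ∷ xs) rewrite p≗q x with q x
  ... | true  = cong suc (countB-cong p≗q xs)
  ... | false = countB-cong p≗q xs

  count : {P : Pred X ℓ} → Decidable P → List X → ℕ
  count P? = countB (λ x → does (P? x))

  module _ {P : Pred X ℓ} (P? : Decidable P) where

    count-∷ : (x : X) (xs : List X) → count P? (x ∷ xs) ≡ 𝟙 (does (P? x)) + count P? xs
    count-∷ x xs with does (P? x)
    ... | true  = refl
    ... | false = refl

    count≡∑ : (xs : List X) → count P? xs ≡ ∑ xs (λ x → 𝟙 (does (P? x)))
    count≡∑ []       = refl
    count≡∑ (x ∷ xs) = trans (count-∷ x xs) (cong (𝟙 (does (P? x)) +_) (count≡∑ xs))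

    count-none : (xs : List X) → (∀ x → ¬ P x) → count P? xs ≡ 0
    count-none []       ¬P = refl
    count-none (x ∷ xs) ¬P rewrite dec-false (P? x) (¬P x) = count-none xs ¬P

    count-++ : (xs ys : List X) → count P? (xs ++ ys) ≡ count P? xs + count P? ys
    count-++ []       ys = refl
    count-++ (x ∷ xs) ys with does (P? x)
    ... | true  = cong suc (count-++ xs ys)
    ... | false = count-++ xs ys

    count-map : (f : Y → X) (xs : List Y) → count P? (map f xs) ≡ count (P? ∘ f) xs
    count-map f []       = refl
    count-map f (x ∷ xs) with does (P? (f x))
    ... | true  = cong suc (count-map f xs)
    ... | false = count-map f xs

    count-cong : {Q : Pred X ℓ′} (Q? : Decidable Q) → (∀ x → P x ⇔ Q x) → (xs : List X) → count P? xs ≡ count Q? xs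
    count-cong Q? P⇔Q = countB-cong (λ x → does-⇔ (P⇔Q x) (P? x) (Q? x))

    count-split : {Q : Pred X ℓ′} (Q? : Decidable Q) (xs : List X) →
                  count P? xs ≡ count (P? ∩? Q?) xs + count (P? ∩? ∁? Q?) xs
    count-split Q? []       = refl
    count-split Q? (x ∷ xs) with does (P? x) | does (Q? x)
    ... | true  | true  = cong suc (count-split Q? xs)
    ... | true  | false = trans (cong suc (count-split Q? xs)) (sym (+-suc _ _))
    ... | false | _     = count-split Q? xs

  count-cartesianProduct : {P : Pred X ℓ} {Q : Pred Y ℓ′} (P? : Decidable P) (Q? : Decidable Q) (xs : List X) (ys : List Y) →
                           count (λ u → P? (proj₁ u) ×-dec Q? (proj₂ u)) (cartesianProduct xs ys) ≡ count P? xs * count Q? ys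
  count-cartesianProduct P? Q? []       ys = refl
  count-cartesianProduct P? Q? (x ∷ xs) ys = begin
    count PQ? (map (x ,_) ys ++ cartesianProduct xs ys)
      ≡⟨ count-++ PQ? (map (x ,_) ys) _ ⟩
    count PQ? (map (x ,_) ys) + count PQ? (cartesianProduct xs ys)
      ≡⟨ cong₂ _+_ (count-map PQ? (x ,_) ys) (count-cartesianProduct P? Q? xs ys) ⟩
    count (λ y → P? x ×-dec Q? y) ys + count P? xs * count Q? ys
      ≡⟨ cong (_+ count P? xs * count Q? ys) (row (P? x)) ⟩
    𝟙 (does (P? x)) * count Q? ys + count P? xs * count Q? ys
      ≡⟨ sym (*-distribʳ-+ (count Q? ys) (𝟙 (does (P? x))) (count P? xs)) ⟩
    (𝟙 (does (P? x)) + count P? xs) * count Q? ys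
      ≡⟨ cong (_* count Q? ys) (count-∷ P? x xs) ⟨
    count P? (x ∷ xs) * count Q? ys ∎
    where
    PQ? = λ u → P? (proj₁ u) ×-dec Q? (proj₂ u)
    row : (px : Dec _) → count (λ y → px ×-dec Q? y) ys ≡ 𝟙 (does px) * count Q? ys
    row (yes _) = sym (+-identityʳ (count Q? ys))
    row (no ¬p) = count-none (λ y → no ¬p ×-dec Q? y) ys (λ _ → ¬p ∘ proj₁)

  record Enumerates (_≟_ : DecidableEquality X) (xs : List X) : Set where
    constructor enumerates
    field occurs-once : ∀ a → count (_≟ a) xs ≡ 1

  open Enumerates using (occurs-once)


  allFin-suc : ∀ n → allFin (suc n) ≡ zero ∷ map suc (allFin n)
  allFin-suc n = cong (zero ∷_) (sym (map-tabulate (λ i → i) suc))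

  enumerates-allFin : ∀ n → Enumerates _≟ᶠ_ (allFin n)
  enumerates-allFin (suc n) .occurs-once a = trans (cong (count (_≟ᶠ a)) (allFin-suc n)) (go a)
    where
    go : ∀ a → count (_≟ᶠ a) (zero ∷ map suc (allFin n)) ≡ 1
    go zero    = cong suc (trans (count-map (_≟ᶠ zero) suc (allFin n)) (count-none (λ i → suc i ≟ᶠ zero) (allFin n) (λ _ ())))
    go (suc b) = begin
      count (_≟ᶠ suc b) (map suc (allFin n)) ≡⟨ count-map (_≟ᶠ suc b) suc (allFin n) ⟩
      count (λ i → suc i ≟ᶠ suc b) (allFin n)
        ≡⟨ count-cong (λ i → suc i ≟ᶠ suc b) (_≟ᶠ b) (λ _ → mk⇔ Fin.suc-injective (cong suc)) (allFin n) ⟩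
      count (_≟ᶠ b) (allFin n)               ≡⟨ enumerates-allFin n .occurs-once b ⟩
      1                                      ∎

  enumerates-map : {_≟X_ : DecidableEquality X} (_≟Y_ : DecidableEquality Y) {xs : List X}
                   (f : X → Y) (f⁻¹ : Y → X) → (∀ c → f (f⁻¹ c) ≡ c) → (∀ a → f⁻¹ (f a) ≡ a) →
                   Enumerates _≟X_ xs → Enumerates _≟Y_ (map f xs)
  enumerates-map {_≟X_ = _≟X_} _≟Y_ {xs} f f⁻¹ ff⁻¹ f⁻¹f enum .occurs-once c = begin
    count (_≟Y c) (map f xs)          ≡⟨ count-map (_≟Y c) f xs ⟩
    count (λ x → f x ≟Y c) xs         ≡⟨ count-cong (λ x → f x ≟Y c) (_≟X f⁻¹ c) fibre xs ⟩
    count (_≟X f⁻¹ c) xs              ≡⟨ enum .occurs-once (f⁻¹ c) ⟩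
    1                                 ∎
    where
    fibre : ∀ x → f x ≡ c ⇔ x ≡ f⁻¹ c
    fibre x = mk⇔ (λ fx≡c → trans (sym (f⁻¹f x)) (cong f⁻¹ fx≡c)) (λ x≡f⁻¹c → trans (cong f x≡f⁻¹c) (ff⁻¹ c))

  enumerates-cartesianProduct : {_≟X_ : DecidableEquality X} {_≟Y_ : DecidableEquality Y} {xs : List X} {ys : List Y} →
                                Enumerates _≟X_ xs → Enumerates _≟Y_ ys →
                                Enumerates (×.≡-dec _≟X_ _≟Y_) (cartesianProduct xs ys)
  enumerates-cartesianProduct {_≟X_ = _≟X_} {_≟Y_} {xs} {ys} enumX enumY .occurs-once (a , b) = begin
    count (_≟× (a , b)) (cartesianProduct xs ys)
      ≡⟨ count-cong (_≟× (a , b)) (λ u → (proj₁ u ≟X a) ×-dec (proj₂ u ≟Y b))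
                    (λ _ → mk⇔ (λ { refl → refl , refl }) (λ { (refl , refl) → refl })) (cartesianProduct xs ys) ⟩
    count (λ u → (proj₁ u ≟X a) ×-dec (proj₂ u ≟Y b)) (cartesianProduct xs ys)
      ≡⟨ count-cartesianProduct (_≟X a) (_≟Y b) xs ys ⟩
    count (_≟X a) xs * count (_≟Y b) ys
      ≡⟨ cong₂ _*_ (enumX .occurs-once a) (enumY .occurs-once b) ⟩
    1 ∎
    where _≟×_ = ×.≡-dec _≟X_ _≟Y_

  vecsOver-suc : {X : Set} (m : ℕ) (xs : List X) → vecsOver (suc m) xs ≡ map (λ u → proj₁ u ∷ proj₂ u) (cartesianProduct xs (vecsOver m xs))
  vecsOver-suc {X} m xs = go xs
    where
    cons = λ (u : X × Vec X m) → proj₁ u ∷ proj₂ u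
    go : (zs : List X) → concatMap (λ z → map (z ∷_) (vecsOver m xs)) zs ≡ map cons (cartesianProduct zs (vecsOver m xs))
    go []       = refl
    go (z ∷ zs) = begin
      map (z ∷_) (vecsOver m xs) ++ concatMap (λ z → map (z ∷_) (vecsOver m xs)) zs
        ≡⟨ cong₂ _++_ (map-∘ (vecsOver m xs)) (go zs) ⟩
      map cons (map (z ,_) (vecsOver m xs)) ++ map cons (cartesianProduct zs (vecsOver m xs))
        ≡⟨ map-++ cons (map (z ,_) (vecsOver m xs)) _ ⟨
      map cons (cartesianProduct (z ∷ zs) (vecsOver m xs)) ∎

  enumerates-vecsOver : {_≟_ : DecidableEquality X} {xs : List X} → Enumerates _≟_ xs →
                        ∀ m → Enumerates (Vecₚ.≡-dec _≟_) (vecsOver m xs)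
  enumerates-vecsOver enum zero    .occurs-once [] = refl
  enumerates-vecsOver {_≟_ = _≟_} {xs} enum (suc m) .occurs-once v =
    trans (cong (count (λ u → Vecₚ.≡-dec _≟_ u v)) (vecsOver-suc m xs))
          (enumerates-map (Vecₚ.≡-dec _≟_) (λ u → proj₁ u ∷ proj₂ u) (λ { (x ∷ u) → x , u }) (λ { (x ∷ u) → refl }) (λ _ → refl)
                          enum-pairs .occurs-once v)
    where
    enum-pairs : Enumerates (×.≡-dec _≟_ (Vecₚ.≡-dec _≟_)) (cartesianProduct xs (vecsOver m xs))
    enum-pairs = enumerates-cartesianProduct enum (enumerates-vecsOver enum m)

  module _ {P : Pred X ℓ} {Q : Pred Y ℓ′} (P? : Decidable P) (Q? : Decidable Q)
           {_≟X_ : DecidableEquality X} {_≟Y_ : DecidableEquality Y} {xs : List X} {ys : List Y}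
           (enumX : Enumerates _≟X_ xs) (enumY : Enumerates _≟Y_ ys)
           (f : X → Y) (g : Y → X) (P⇒Qf : ∀ {x} → P x → Q (f x)) (Q⇒Pg : ∀ {y} → Q y → P (g y))
           (gf≡id : ∀ {x} → P x → g (f x) ≡ x) (fg≡id : ∀ {y} → Q y → f (g y) ≡ y) where

    private
      Graph? : ∀ x y → Dec (P x × y ≡ f x)
      Graph? x y = P? x ×-dec (y ≟Y f x)

      row : ∀ x → ∑ ys (λ y → 𝟙 (does (Graph? x y))) ≡ 𝟙 (does (P? x))
      row x with P? x
      ... | yes _ = trans (sym (count≡∑ (_≟Y f x) ys)) (enumY .occurs-once (f x))
      ... | no  _ = ∑-zero ys (λ _ → refl)

      column : ∀ y → ∑ xs (λ x → 𝟙 (does (Graph? x y))) ≡ 𝟙 (does (Q? y))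
      column y with Q? y
      ... | yes q = begin
        ∑ xs (λ x → 𝟙 (does (Graph? x y))) ≡⟨ count≡∑ (λ x → Graph? x y) xs ⟨
        count (λ x → Graph? x y) xs        ≡⟨ count-cong (λ x → Graph? x y) (_≟X g y) (λ x → mk⇔ (graph⇒g x) (g⇒graph x)) xs ⟩
        count (_≟X g y) xs                 ≡⟨ enumX .occurs-once (g y) ⟩
        1                                  ∎
        where
        graph⇒g : ∀ x → P x × y ≡ f x → x ≡ g y
        graph⇒g x (p , refl) = sym (gf≡id p)
        g⇒graph : ∀ x → x ≡ g y → P x × y ≡ f x
        g⇒graph x refl = Q⇒Pg q , sym (fg≡id q)
      ... | no ¬q = trans (sym (count≡∑ (λ x → Graph? x y) xs))
                          (count-none (λ x → Graph? x y) xs (λ { x (p , refl) → ¬q (P⇒Qf p) }))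

    -- Double counting of the pairs (x , f x) with P x.
    count-bijection : count P? xs ≡ count Q? ys
    count-bijection = begin
      count P? xs                                          ≡⟨ count≡∑ P? xs ⟩
      ∑ xs (λ x → 𝟙 (does (P? x)))                         ≡⟨ ∑-cong xs row ⟨
      ∑ xs (λ x → ∑ ys (λ y → 𝟙 (does (Graph? x y))))      ≡⟨ ∑-swap xs ys _ ⟩
      ∑ ys (λ y → ∑ xs (λ x → 𝟙 (does (Graph? x y))))      ≡⟨ ∑-cong ys column ⟩
      ∑ ys (λ y → 𝟙 (does (Q? y)))                         ≡⟨ count≡∑ Q? ys ⟨
      count Q? ys                                          ∎

  count-allFin-< : ∀ {N a} → a ≤ N → count (λ i → toℕ i <? a) (allFin N) ≡ a
  count-allFin-< {N}     {zero}  _         = count-none (λ i → toℕ i <? 0) (allFin N) (λ _ ())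
  count-allFin-< {suc N} {suc a} (s≤s a≤N) = begin
    count (λ i → toℕ i <? suc a) (allFin (suc N))          ≡⟨ cong (count (λ i → toℕ i <? suc a)) (allFin-suc N) ⟩
    suc (count (λ i → toℕ i <? suc a) (map suc (allFin N))) ≡⟨ cong suc (count-map (λ i → toℕ i <? suc a) suc (allFin N)) ⟩
    suc (count (λ i → toℕ i <? a) (allFin N))               ≡⟨ cong suc (count-allFin-< a≤N) ⟩
    suc a                                                   ∎

  count-allFin-≥ : ∀ {N a} → a ≤ N → count (λ i → a ≤? toℕ i) (allFin N) ≡ N ∸ a
  count-allFin-≥ {zero}  {zero}  _         = refl
  count-allFin-≥ {suc N} {a}     a≤N       = begin
    count (λ i → a ≤? toℕ i) (allFin (suc N))                    ≡⟨ cong (count (λ i → a ≤? toℕ i)) (allFin-suc N) ⟩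
    count (λ i → a ≤? toℕ i) (zero ∷ map suc (allFin N))         ≡⟨ count-∷ (λ i → a ≤? toℕ i) zero (map suc (allFin N)) ⟩
    𝟙 (does (a ≤? 0)) + count (λ i → a ≤? toℕ i) (map suc (allFin N))
      ≡⟨ cong (𝟙 (does (a ≤? 0)) +_) (count-map (λ i → a ≤? toℕ i) suc (allFin N)) ⟩
    𝟙 (does (a ≤? 0)) + count (λ i → a ≤? suc (toℕ i)) (allFin N) ≡⟨ step a a≤N ⟩
    suc N ∸ a                                                    ∎
    where
    step : ∀ a → a ≤ suc N → 𝟙 (does (a ≤? 0)) + count (λ i → a ≤? suc (toℕ i)) (allFin N) ≡ suc N ∸ a
    step zero    _         = cong suc (count-allFin-≥ {N} {0} z≤n)
    step (suc a) (s≤s a≤N) = trans (count-cong (λ i → suc a ≤? suc (toℕ i)) (λ i → a ≤? toℕ i) (λ _ → mk⇔ s≤s⁻¹ s≤s) (allFin N))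
                                   (count-allFin-≥ a≤N)

  any-cong : {p q : X → Bool} → (∀ x → p x ≡ q x) → (xs : List X) → any p xs ≡ any q xs
  any-cong p≗q []       = refl
  any-cong p≗q (x ∷ xs) = cong₂ _∨_ (p≗q x) (any-cong p≗q xs)

  any-map : (p : X → Bool) (f : Fin n → X) (xs : List (Fin n)) → any p (map f xs) ≡ any (p ∘ f) xs
  any-map p f []       = refl
  any-map p f (x ∷ xs) = cong (p (f x) ∨_) (any-map p f xs)

  anyFin-cong : {p q : Fin n → Bool} → (∀ i → p i ≡ q i) → anyFin n p ≡ anyFin n q
  anyFin-cong {n} p≗q = any-cong p≗q (allFin n)

  anyFin-suc : (p : Fin (suc n) → Bool) → anyFin (suc n) p ≡ p zero ∨ anyFin n (p ∘ suc)
  anyFin-suc {n} p = trans (cong (any p) (allFin-suc n)) (cong (p zero ∨_) (any-map p suc (allFin n)))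

  does-any? : {P : Pred (Fin n) ℓ} (P? : Decidable P) → does (any? P?) ≡ anyFin n (does ∘ P?)
  does-any? {zero}  P? = refl
  does-any? {suc n} P? = trans (cong (does (P? zero) ∨_) (does-any? (P? ∘ suc))) (sym (anyFin-suc (does ∘ P?)))

  module _ {P : Fin n → Fin n → Set ℓ} (P? : ∀ i j → Dec (P i j)) where

    does-any²? : does (any? λ i → any? (P? i)) ≡ anyFin n λ i → anyFin n λ j → does (P? i j)
    does-any²? = trans (does-any? (λ i → any? (P? i))) (anyFin-cong λ i → does-any? (P? i))

  module _ {P : Fin n → Fin n → Fin n → Set ℓ} (P? : ∀ i j k → Dec (P i j k)) where

    does-any³? : does (any? λ i → any? λ j → any? (P? i j)) ≡ anyFin n λ i → anyFin n λ j → anyFin n λ k → does (P? i j k)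
    does-any³? = trans (does-any? (λ i → any? λ j → any? (P? i j))) (anyFin-cong λ i → does-any²? (P? i))

  anyFin³-cong : {p q : Fin n → Fin n → Fin n → Bool} → (∀ i j k → p i j k ≡ q i j k) →
               (anyFin n λ i → anyFin n λ j → anyFin n (p i j)) ≡ (anyFin n λ i → anyFin n λ j → anyFin n (q i j))
  anyFin³-cong p≗q = anyFin-cong λ i → anyFin-cong λ j → anyFin-cong (p≗q i j)

  does-≤? : ∀ m n → does (m ≤? n) ≡ not (n <ᵇ m)
  does-≤? m n = does-⇔ (mk⇔ ≤⇒≯ ≮⇒≥) (m ≤? n) (¬? (n <? m))

  infixl 9 _!_
  _!_ : {m : ℕ} → Vec (Fin n) m → Fin m → ℕ
  w ! j = toℕ (lookup w j)

  IsPerm : Vec (Fin n) n → Set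
  IsPerm w = ∀ i j → lookup w i ≡ lookup w j → i ≡ j

  HasRepeat : Vec (Fin n) n → Set
  HasRepeat w = ∃₂ λ i j → toℕ i < toℕ j × w ! i ≡ w ! j

  Pattern3|12 : ℕ → Vec (Fin n) n → Fin n → Fin n → Fin n → Set
  Pattern3|12 r w j₁ j₂ j₃ = toℕ j₁ < r × r ≤ toℕ j₂ × toℕ j₂ < toℕ j₃ × w ! j₂ < w ! j₃ × w ! j₃ < w ! j₁

  Pattern23|1 : ℕ → Vec (Fin n) n → Fin n → Fin n → Fin n → Set
  Pattern23|1 r w j₁ j₂ j₃ = toℕ j₁ < toℕ j₂ × toℕ j₂ < r × r ≤ toℕ j₃ × w ! j₃ < w ! j₁ × w ! j₁ < w ! j₂

  Occurs3|12 : ℕ → Vec (Fin n) n → Set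
  Occurs3|12 r w = ∃ λ j₁ → ∃ λ j₂ → ∃ λ j₃ → Pattern3|12 r w j₁ j₂ j₃

  Occurs23|1 : ℕ → Vec (Fin n) n → Set
  Occurs23|1 r w = ∃ λ j₁ → ∃ λ j₂ → ∃ λ j₃ → Pattern23|1 r w j₁ j₂ j₃

  Avoiding : ℕ → Vec (Fin n) n → Set
  Avoiding r w = IsPerm w × ¬ Occurs3|12 r w × ¬ Occurs23|1 r w

  module _ {n : ℕ} (w : Vec (Fin n) n) where

    ¬HasRepeat⇒IsPerm : ¬ HasRepeat w → IsPerm w
    ¬HasRepeat⇒IsPerm ¬rep i j wi≡wj with <-cmp (toℕ i) (toℕ j)
    ... | tri< i<j _ _ = contradiction (i , j , i<j , cong toℕ wi≡wj) ¬rep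
    ... | tri≈ _ i≡j _ = toℕ-injective i≡j
    ... | tri> _ _ j<i = contradiction (j , i , j<i , cong toℕ (sym wi≡wj)) ¬rep

    IsPerm⇒¬HasRepeat : IsPerm w → ¬ HasRepeat w
    IsPerm⇒¬HasRepeat perm (i , j , i<j , wi≡wj) = <-irrefl (cong toℕ (perm i j (toℕ-injective wi≡wj))) i<j

    hasRepeat? : Dec (HasRepeat w)
    hasRepeat? = any? λ i → any? λ j → (toℕ i <? toℕ j) ×-dec (w ! i ≟ w ! j)

    isPerm? : Dec (IsPerm w)
    isPerm? = Dec.map′ ¬HasRepeat⇒IsPerm IsPerm⇒¬HasRepeat (¬? hasRepeat?)

    isPerm-reflects : isPerm w ≡ does isPerm?
    isPerm-reflects = cong not (sym (does-any²? (λ i j → (toℕ i <? toℕ j) ×-dec (w ! i ≟ w ! j))))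

  module _ {n : ℕ} (r : ℕ) (w : Vec (Fin n) n) where

    pattern3|12? : ∀ j₁ j₂ j₃ → Dec (Pattern3|12 r w j₁ j₂ j₃)
    pattern3|12? j₁ j₂ j₃ =
      (toℕ j₁ <? r) ×-dec (r ≤? toℕ j₂) ×-dec (toℕ j₂ <? toℕ j₃) ×-dec (w ! j₂ <? w ! j₃) ×-dec (w ! j₃ <? w ! j₁)

    pattern23|1? : ∀ j₁ j₂ j₃ → Dec (Pattern23|1 r w j₁ j₂ j₃)
    pattern23|1? j₁ j₂ j₃ =
      (toℕ j₁ <? toℕ j₂) ×-dec (toℕ j₂ <? r) ×-dec (r ≤? toℕ j₃) ×-dec (w ! j₃ <? w ! j₁) ×-dec (w ! j₁ <? w ! j₂)

    occurs3|12? : Dec (Occurs3|12 r w)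
    occurs3|12? = any? λ j₁ → any? λ j₂ → any? (pattern3|12? j₁ j₂)

    occurs23|1? : Dec (Occurs23|1 r w)
    occurs23|1? = any? λ j₁ → any? λ j₂ → any? (pattern23|1? j₁ j₂)

    avoiding? : Dec (Avoiding r w)
    avoiding? = isPerm? w ×-dec ¬? occurs3|12? ×-dec ¬? occurs23|1?

    contains3|12-reflects : contains3|12 r w ≡ does occurs3|12?
    contains3|12-reflects = sym (trans (does-any³? pattern3|12?) (anyFin³-cong λ j₁ j₂ j₃ →
      cong (λ b → (toℕ j₁ <ᵇ r) ∧ b ∧ (toℕ j₂ <ᵇ toℕ j₃) ∧ (w ! j₂ <ᵇ w ! j₃) ∧ (w ! j₃ <ᵇ w ! j₁)) (does-≤? r (toℕ j₂))))

    contains23|1-reflects : contains23|1 r w ≡ does occurs23|1?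
    contains23|1-reflects = sym (trans (does-any³? pattern23|1?) (anyFin³-cong λ j₁ j₂ j₃ →
      cong (λ b → (toℕ j₁ <ᵇ toℕ j₂) ∧ (toℕ j₂ <ᵇ r) ∧ b ∧ (w ! j₃ <ᵇ w ! j₁) ∧ (w ! j₁ <ᵇ w ! j₂)) (does-≤? r (toℕ j₃))))

  words : (n : ℕ) → List (Vec (Fin n) n)
  words n = vecsOver n (allFin n)

  k≡count-avoiding : ∀ r n → k r n ≡ count (avoiding? r) (words n)
  k≡count-avoiding r n = countB-cong reflects (words n)
    where
    reflects : ∀ w → isPerm w ∧ not (contains3|12 r w) ∧ not (contains23|1 r w) ≡ does (avoiding? r w)
    reflects w = cong₂ _∧_ (isPerm-reflects w) (cong₂ (λ b c → not b ∧ not c) (contains3|12-reflects r w) (contains23|1-reflects r w))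

  AscentLeft : ℕ → Vec (Fin n) n → Fin n → Fin n → Set
  AscentLeft r w j₁ j₂ = toℕ j₁ < toℕ j₂ × toℕ j₂ < r × w ! j₁ < w ! j₂

  AscentRight : ℕ → Vec (Fin n) n → Fin n → Fin n → Set
  AscentRight r w j₁ j₂ = r ≤ toℕ j₁ × toℕ j₁ < toℕ j₂ × w ! j₁ < w ! j₂

  DecreasingHalves : ℕ → Vec (Fin n) n → Set
  DecreasingHalves r w = IsPerm w × ¬ (∃₂ (AscentLeft r w)) × ¬ (∃₂ (AscentRight r w))

  MinOnLeft : ℕ → Vec (Fin n) n → Set
  MinOnLeft r w = ∃ λ j → toℕ j < r × w ! j ≡ 0

  MaxOnRight : ℕ → Vec (Fin n) n → Set
  MaxOnRight {n} r w = ∃ λ j → r ≤ toℕ j × suc (w ! j) ≡ n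

  module _ {n : ℕ} (r : ℕ) (w : Vec (Fin n) n) where

    decreasingHalves? : Dec (DecreasingHalves r w)
    decreasingHalves? = isPerm? w ×-dec ¬? (any? λ j₁ → any? λ j₂ → ascentLeft? j₁ j₂) ×-dec ¬? (any? λ j₁ → any? λ j₂ → ascentRight? j₁ j₂)
      where
      ascentLeft? = λ j₁ j₂ → (toℕ j₁ <? toℕ j₂) ×-dec (toℕ j₂ <? r) ×-dec (w ! j₁ <? w ! j₂)
      ascentRight? = λ j₁ j₂ → (r ≤? toℕ j₁) ×-dec (toℕ j₁ <? toℕ j₂) ×-dec (w ! j₁ <? w ! j₂)

    minOnLeft? : Dec (MinOnLeft r w)
    minOnLeft? = any? λ j → (toℕ j <? r) ×-dec (w ! j ≟ 0)

    maxOnRight? : Dec (MaxOnRight r w)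
    maxOnRight? = any? λ j → (r ≤? toℕ j) ×-dec (suc (w ! j) ≟ n)

  -- Inserting and deleting a value

  IsPerm-surjective : (w : Vec (Fin n) n) → IsPerm w → ∀ v → ∃ λ j → lookup w j ≡ v
  IsPerm-surjective {suc m} w perm v with any? (λ j → lookup w j ≟ᶠ v)
  ... | yes found = found
  ... | no  v∉w   with pigeonhole (n<1+n m) (λ j → punchOut {i = v} {j = lookup w j} (λ v≡wj → v∉w (j , sym v≡wj)))
  ... | i , j , i<j , eq = contradiction (perm i j (punchOut-injective {i = v} _ _ eq)) (λ i≡j → <-irrefl (cong toℕ i≡j) i<j)

  punchIn-preimage : {i j : Fin (suc m)} → j ≢ i → ∃ λ j′ → punchIn i j′ ≡ j
  punchIn-preimage j≢i = punchOut (j≢i ∘ sym) , punchIn-punchOut (j≢i ∘ sym)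

  insertValue : Fin (suc m) → Fin (suc m) → Vec (Fin m) m → Vec (Fin (suc m)) (suc m)
  insertValue v i w = insertAt (Vec.map (punchIn v) w) i v

  module _ (v i : Fin (suc m)) (w : Vec (Fin m) m) where

    lookup-insertValue-at : lookup (insertValue v i w) i ≡ v
    lookup-insertValue-at = Vecₚ.insertAt-lookup (Vec.map (punchIn v) w) i v

    lookup-insertValue-punchIn : ∀ j → lookup (insertValue v i w) (punchIn i j) ≡ punchIn v (lookup w j)
    lookup-insertValue-punchIn j = trans (Vecₚ.insertAt-punchIn (Vec.map (punchIn v) w) i v j) (Vecₚ.lookup-map j (punchIn v) w)

    insertValue-position : ∀ j → lookup (insertValue v i w) j ≡ v → j ≡ i
    insertValue-position j wj≡v with j ≟ᶠ i
    ... | yes j≡i = j≡i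
    ... | no  j≢i with punchIn-preimage j≢i
    ... | j′ , refl = contradiction (trans (sym (lookup-insertValue-punchIn j′)) wj≡v) (punchInᵢ≢i v (lookup w j′))

    IsPerm-insertValue : IsPerm w → IsPerm (insertValue v i w)
    IsPerm-insertValue perm x y eq with x ≟ᶠ i | y ≟ᶠ i
    ... | yes refl | yes refl = refl
    ... | yes refl | no  _    = sym (insertValue-position y (trans (sym eq) lookup-insertValue-at))
    ... | no  _    | yes refl = insertValue-position x (trans eq lookup-insertValue-at)
    ... | no  x≢i  | no  y≢i  with punchIn-preimage x≢i | punchIn-preimage y≢i
    ... | x′ , refl | y′ , refl = cong (punchIn i) (perm x′ y′ (punchIn-injective v _ _
      (trans (sym (lookup-insertValue-punchIn x′)) (trans eq (lookup-insertValue-punchIn y′)))))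

    IsPerm-insertValue⁻ : IsPerm (insertValue v i w) → IsPerm w
    IsPerm-insertValue⁻ perm x y eq = punchIn-injective i x y (perm (punchIn i x) (punchIn i y) (begin
      lookup (insertValue v i w) (punchIn i x) ≡⟨ lookup-insertValue-punchIn x ⟩
      punchIn v (lookup w x)                   ≡⟨ cong (punchIn v) eq ⟩
      punchIn v (lookup w y)                   ≡⟨ lookup-insertValue-punchIn y ⟨
      lookup (insertValue v i w) (punchIn i y) ∎))

  -- A left inverse of punchIn v; the value it assigns to v itself is junk.
  unpunch : Fin (suc (suc m)) → Fin (suc (suc m)) → Fin (suc m)
  unpunch zero    zero    = zero
  unpunch zero    (suc x) = x
  unpunch (suc v) zero    = zero
  unpunch {zero}  (suc v) (suc x) = zero
  unpunch {suc m} (suc v) (suc x) = suc (unpunch v x)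

  unpunch-punchIn : (v : Fin (suc (suc m))) (x : Fin (suc m)) → unpunch v (punchIn v x) ≡ x
  unpunch-punchIn zero    x       = refl
  unpunch-punchIn (suc v) zero    = refl
  unpunch-punchIn {suc m} (suc v) (suc x) = cong suc (unpunch-punchIn v x)

  punchIn-unpunch : (v x : Fin (suc (suc m))) → x ≢ v → punchIn v (unpunch v x) ≡ x
  punchIn-unpunch zero    zero    x≢v = contradiction refl x≢v
  punchIn-unpunch zero    (suc x) x≢v = refl
  punchIn-unpunch (suc v) zero    x≢v = refl
  punchIn-unpunch {zero}  (suc zero) (suc zero) x≢v = contradiction refl x≢v
  punchIn-unpunch {suc m} (suc v) (suc x) x≢v = cong suc (punchIn-unpunch v x (x≢v ∘ cong suc))

  unpunchAll : Fin (suc m) → Vec (Fin (suc m)) m → Vec (Fin m) m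
  unpunchAll {zero}  v []     = []
  unpunchAll {suc m} v xs     = Vec.map (unpunch v) xs

  unpunchAll-punchIn : (v : Fin (suc m)) (xs : Vec (Fin m) m) → unpunchAll v (Vec.map (punchIn v) xs) ≡ xs
  unpunchAll-punchIn {zero}  v []  = refl
  unpunchAll-punchIn {suc m} v xs  = trans (sym (Vecₚ.map-∘ (unpunch v) (punchIn v) xs))
                                           (trans (Vecₚ.map-cong (unpunch-punchIn v) xs) (Vecₚ.map-id xs))

  punchIn-unpunchAll : (v : Fin (suc m)) (xs : Vec (Fin (suc m)) m) → (∀ j → lookup xs j ≢ v) → Vec.map (punchIn v) (unpunchAll v xs) ≡ xs
  punchIn-unpunchAll {zero}  v []  _  = refl
  punchIn-unpunchAll {suc m} v xs  ≢v = trans (sym (Vecₚ.map-∘ (punchIn v) (unpunch v) xs)) (go xs ≢v)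
    where
    go : ∀ {l} (ys : Vec (Fin (suc (suc m))) l) → (∀ j → lookup ys j ≢ v) → Vec.map (punchIn v ∘ unpunch v) ys ≡ ys
    go []       _   = refl
    go (y ∷ ys) ≢v′ = cong₂ _∷_ (punchIn-unpunch v y (≢v′ zero)) (go ys (≢v′ ∘ suc))

  -- The position of v in w, or the junk value zero when v does not occur.
  positionOf : Fin n → Vec (Fin n) (suc m) → Fin (suc m)
  positionOf v w with any? (λ j → lookup w j ≟ᶠ v)
  ... | yes (j , _) = j
  ... | no  _       = zero

  lookup-positionOf : (v : Fin n) (w : Vec (Fin n) (suc m)) → (∃ λ j → lookup w j ≡ v) → lookup w (positionOf v w) ≡ v
  lookup-positionOf v w v∈w with any? (λ j → lookup w j ≟ᶠ v)
  ... | yes (_ , wj≡v) = wj≡v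
  ... | no  v∉w        = contradiction v∈w v∉w

  lookup-removeAt : {A : Set} (xs : Vec A (suc m)) (i : Fin (suc m)) (j : Fin m) → lookup (removeAt xs i) j ≡ lookup xs (punchIn i j)
  lookup-removeAt xs i j = trans (cong (lookup (removeAt xs i)) (sym (punchOut-punchIn i))) (Vecₚ.removeAt-punchOut xs (punchInᵢ≢i i j ∘ sym))

  deleteValue : Fin (suc m) → Vec (Fin (suc m)) (suc m) → Fin (suc m) × Vec (Fin m) m
  deleteValue v w = i , unpunchAll v (removeAt w i)
    where i = positionOf v w

  deleteValue-insertValue : (v i : Fin (suc m)) (w : Vec (Fin m) m) → deleteValue v (insertValue v i w) ≡ (i , w)
  deleteValue-insertValue v i w = begin
    (p , unpunchAll v (removeAt (insertValue v i w) p)) ≡⟨ cong (λ x → x , unpunchAll v (removeAt (insertValue v i w) x)) p≡i ⟩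
    (i , unpunchAll v (removeAt (insertValue v i w) i)) ≡⟨ cong (λ xs → i , unpunchAll v xs) (Vecₚ.removeAt-insertAt (Vec.map (punchIn v) w) i v) ⟩
    (i , unpunchAll v (Vec.map (punchIn v) w))              ≡⟨ cong (i ,_) (unpunchAll-punchIn v w) ⟩
    (i , w)                                             ∎
    where
    p = positionOf v (insertValue v i w)
    p≡i : p ≡ i
    p≡i = insertValue-position v i w p (lookup-positionOf v (insertValue v i w) (i , lookup-insertValue-at v i w))

  insertValue-deleteValue : (v : Fin (suc m)) {w : Vec (Fin (suc m)) (suc m)} → IsPerm w →
                            uncurry (insertValue v) (deleteValue v w) ≡ w
  insertValue-deleteValue v {w} perm = begin
    insertAt (Vec.map (punchIn v) (unpunchAll v (removeAt w i))) i v ≡⟨ cong (λ xs → insertAt xs i v) (punchIn-unpunchAll v (removeAt w i) ≢v) ⟩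
    insertAt (removeAt w i) i v                                  ≡⟨ cong (insertAt (removeAt w i) i) wi≡v ⟨
    insertAt (removeAt w i) i (lookup w i)                       ≡⟨ Vecₚ.insertAt-removeAt w i ⟩
    w                                                            ∎
    where
    i = positionOf v w
    wi≡v = lookup-positionOf v w (IsPerm-surjective w perm v)
    ≢v : ∀ j → lookup (removeAt w i) j ≢ v
    ≢v j eq = punchInᵢ≢i i j (perm (punchIn i j) i (trans (sym (lookup-removeAt w i j)) (trans eq (sym wi≡v))))

  enumerates-words : ∀ n → Enumerates (Vecₚ.≡-dec _≟ᶠ_) (words n)
  enumerates-words n = enumerates-vecsOver (enumerates-allFin n) n

  module _ (v : Fin (suc m)) {P : Pred (Vec (Fin (suc m)) (suc m)) ℓ} (P? : Decidable P) (P⇒IsPerm : ∀ {w} → P w → IsPerm w) where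

    count-deleteValue : {Q : Pred (Fin (suc m)) ℓ′} (Q? : Decidable Q) {R : Pred (Vec (Fin m) m) ℓ″} (R? : Decidable R) →
                        (∀ i w → P (insertValue v i w) ⇔ (Q i × R w)) →
                        count P? (words (suc m)) ≡ count Q? (allFin (suc m)) * count R? (words m)
    count-deleteValue {Q = Q} Q? {R} R? P⇔Q×R = begin
      count P? (words (suc m))
        ≡⟨ count-bijection P? Q×R? (enumerates-words (suc m)) (enumerates-cartesianProduct (enumerates-allFin (suc m)) (enumerates-words m))
                           (deleteValue v) (uncurry (insertValue v)) P⇒Q×R (λ {u} → P⇔Q×R (proj₁ u) (proj₂ u) .from)
                           (λ p → insertValue-deleteValue v (P⇒IsPerm p)) (λ {u} _ → deleteValue-insertValue v (proj₁ u) (proj₂ u)) ⟩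
      count Q×R? (cartesianProduct (allFin (suc m)) (words m))
        ≡⟨ count-cartesianProduct Q? R? (allFin (suc m)) (words m) ⟩
      count Q? (allFin (suc m)) * count R? (words m) ∎
      where
      Q×R? = λ u → Q? (proj₁ u) ×-dec R? (proj₂ u)
      P⇒Q×R : ∀ {w} → P w → Q (proj₁ (deleteValue v w)) × R (proj₂ (deleteValue v w))
      P⇒Q×R {w} p = P⇔Q×R _ _ .to (subst P (sym (insertValue-deleteValue v (P⇒IsPerm p))) p)

    count-deleteValue-at : (c : Fin (suc m)) {R : Pred (Vec (Fin m) m) ℓ″} (R? : Decidable R) →
                           (∀ i w → P (insertValue v i w) ⇔ (i ≡ c × R w)) →
                           count P? (words (suc m)) ≡ count R? (words m)
    count-deleteValue-at c R? P⇔≡c×R = begin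
      count P? (words (suc m))                              ≡⟨ count-deleteValue (_≟ᶠ c) R? P⇔≡c×R ⟩
      count (_≟ᶠ c) (allFin (suc m)) * count R? (words m)  ≡⟨ cong (_* count R? (words m)) (enumerates-allFin (suc m) .occurs-once c) ⟩
      1 * count R? (words m)                                ≡⟨ *-identityˡ (count R? (words m)) ⟩
      count R? (words m)                                    ∎

  toℕ-punchIn-below : (i : Fin (suc m)) (j : Fin m) → toℕ j < toℕ i → toℕ (punchIn i j) ≡ toℕ j
  toℕ-punchIn-below (suc i) zero    _         = refl
  toℕ-punchIn-below (suc i) (suc j) (s≤s j<i) = cong suc (toℕ-punchIn-below i j j<i)

  toℕ-punchIn-above : (i : Fin (suc m)) (j : Fin m) → toℕ i ≤ toℕ j → toℕ (punchIn i j) ≡ suc (toℕ j)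
  toℕ-punchIn-above zero    j       _         = refl
  toℕ-punchIn-above (suc i) (suc j) (s≤s i≤j) = cong suc (toℕ-punchIn-above i j i≤j)

  punchIn-<⇔ : (i : Fin (suc m)) (j k : Fin m) → toℕ j < toℕ k ⇔ toℕ (punchIn i j) < toℕ (punchIn i k)
  punchIn-<⇔ i j k = mk⇔ (λ j<k → ≰⇒> (<⇒≱ j<k ∘ punchIn-cancel-≤ i k j))
                         (λ ↑j<↑k → ≰⇒> (<⇒≱ ↑j<↑k ∘ punchIn-mono-≤ i k j))

  BoundaryShift : Fin (suc m) → ℕ → ℕ → Set
  BoundaryShift {m} i r′ r = (j : Fin m) → toℕ j < r′ ⇔ toℕ (punchIn i j) < r

  boundaryShift-left : (i : Fin (suc m)) (r′ : ℕ) → toℕ i ≤ r′ → BoundaryShift i r′ (suc r′)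
  boundaryShift-left i r′ i≤r′ j with toℕ j <? toℕ i
  ... | yes j<i = mk⇔ (λ _ → subst (_< suc r′) (sym (toℕ-punchIn-below i j j<i)) (<-≤-trans j<i (m≤n⇒m≤1+n i≤r′)))
                      (λ _ → <-≤-trans j<i i≤r′)
  ... | no  j≮i = mk⇔ (λ j<r′ → subst (_< suc r′) (sym (toℕ-punchIn-above i j (≮⇒≥ j≮i))) (s≤s j<r′))
                      (λ ↑j<r → s≤s⁻¹ (subst (_< suc r′) (toℕ-punchIn-above i j (≮⇒≥ j≮i)) ↑j<r))

  boundaryShift-right : (i : Fin (suc m)) (r : ℕ) → r ≤ toℕ i → BoundaryShift i r r
  boundaryShift-right i r r≤i j with toℕ j <? toℕ i
  ... | yes j<i = mk⇔ (subst (_< r) (sym (toℕ-punchIn-below i j j<i))) (subst (_< r) (toℕ-punchIn-below i j j<i))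
  ... | no  j≮i = mk⇔ (λ j<r → contradiction (≤-trans r≤i (≮⇒≥ j≮i)) (<⇒≱ j<r))
                      (λ ↑j<r → contradiction (≤-trans r≤i (≤-trans (≮⇒≥ j≮i) (n≤1+n _)))
                                              (<⇒≱ (subst (_< r) (toℕ-punchIn-above i j (≮⇒≥ j≮i)) ↑j<r)))

  module Insertion (v i : Fin (suc m)) (w : Vec (Fin m) m) where

    W : Vec (Fin (suc m)) (suc m)
    W = insertValue v i w

    ↑ : Fin m → Fin (suc m)
    ↑ = punchIn i

    W-at : W ! i ≡ toℕ v
    W-at = cong toℕ (lookup-insertValue-at v i w)

    W-↑ : ∀ j → W ! ↑ j ≡ toℕ (punchIn v (lookup w j))
    W-↑ j = cong toℕ (lookup-insertValue-punchIn v i w j)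

    W-↑-below : ∀ j → toℕ (lookup w j) < toℕ v → W ! ↑ j ≡ w ! j
    W-↑-below j wj<v = trans (W-↑ j) (toℕ-punchIn-below v (lookup w j) wj<v)

    W-position : ∀ j → W ! j ≡ toℕ v → j ≡ i
    W-position j Wj≡v = insertValue-position v i w j (toℕ-injective Wj≡v)

    order⇔ : ∀ j k → toℕ j < toℕ k ⇔ toℕ (↑ j) < toℕ (↑ k)
    order⇔ = punchIn-<⇔ i

    value⇔ : ∀ j k → w ! j < w ! k ⇔ W ! ↑ j < W ! ↑ k
    value⇔ j k = mk⇔ (λ lt → subst₂ _<_ (sym (W-↑ j)) (sym (W-↑ k)) (punchIn-<⇔ v _ _ .to lt))
                     (λ lt → punchIn-<⇔ v _ _ .from (subst₂ _<_ (W-↑ j) (W-↑ k) lt))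

    Unused² : (Fin (suc m) → Fin (suc m) → Set) → Set
    Unused² X = ∀ j₁ j₂ → X j₁ j₂ → j₁ ≢ i × j₂ ≢ i

    Unused³ : (Fin (suc m) → Fin (suc m) → Fin (suc m) → Set) → Set
    Unused³ X = ∀ j₁ j₂ j₃ → X j₁ j₂ j₃ → j₁ ≢ i × j₂ ≢ i × j₃ ≢ i

    ¬∃²-lift : {X′ : Fin m → Fin m → Set} {X : Fin (suc m) → Fin (suc m) → Set} →
               (∀ j₁ j₂ → X (↑ j₁) (↑ j₂) → X′ j₁ j₂) → Unused² X → ¬ ∃₂ X′ → ¬ ∃₂ X
    ¬∃²-lift lower unused ¬X′ (j₁ , j₂ , x) with unused j₁ j₂ x
    ... | j₁≢i , j₂≢i with punchIn-preimage j₁≢i | punchIn-preimage j₂≢i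
    ... | j₁′ , refl | j₂′ , refl = ¬X′ (j₁′ , j₂′ , lower j₁′ j₂′ x)

    ¬∃³-lift : {X′ : Fin m → Fin m → Fin m → Set} {X : Fin (suc m) → Fin (suc m) → Fin (suc m) → Set} →
               (∀ j₁ j₂ j₃ → X (↑ j₁) (↑ j₂) (↑ j₃) → X′ j₁ j₂ j₃) → Unused³ X →
               ¬ (∃ λ j₁ → ∃₂ (X′ j₁)) → ¬ (∃ λ j₁ → ∃₂ (X j₁))
    ¬∃³-lift lower unused ¬X′ (j₁ , j₂ , j₃ , x) with unused j₁ j₂ j₃ x
    ... | j₁≢i , j₂≢i , j₃≢i with punchIn-preimage j₁≢i | punchIn-preimage j₂≢i | punchIn-preimage j₃≢i
    ... | j₁′ , refl | j₂′ , refl | j₃′ , refl = ¬X′ (j₁′ , j₂′ , j₃′ , lower j₁′ j₂′ j₃′ x)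

    module _ {r′ r : ℕ} (shift : BoundaryShift i r′ r) where

      left⇔ : ∀ j → toℕ j < r′ ⇔ toℕ (↑ j) < r
      left⇔ = shift

      right⇔ : ∀ j → r′ ≤ toℕ j ⇔ r ≤ toℕ (↑ j)
      right⇔ j = mk⇔ (λ r′≤j → ≮⇒≥ (λ ↑j<r → <⇒≱ (shift j .from ↑j<r) r′≤j))
                     (λ r≤↑j → ≮⇒≥ (λ j<r′ → <⇒≱ (shift j .to j<r′) r≤↑j))

      pattern3|12⇔ : ∀ j₁ j₂ j₃ → Pattern3|12 r′ w j₁ j₂ j₃ ⇔ Pattern3|12 r W (↑ j₁) (↑ j₂) (↑ j₃)
      pattern3|12⇔ j₁ j₂ j₃ = left⇔ j₁ ×-⇔ right⇔ j₂ ×-⇔ order⇔ j₂ j₃ ×-⇔ value⇔ j₂ j₃ ×-⇔ value⇔ j₃ j₁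

      pattern23|1⇔ : ∀ j₁ j₂ j₃ → Pattern23|1 r′ w j₁ j₂ j₃ ⇔ Pattern23|1 r W (↑ j₁) (↑ j₂) (↑ j₃)
      pattern23|1⇔ j₁ j₂ j₃ = order⇔ j₁ j₂ ×-⇔ left⇔ j₂ ×-⇔ right⇔ j₃ ×-⇔ value⇔ j₃ j₁ ×-⇔ value⇔ j₁ j₂

      ascentLeft⇔ : ∀ j₁ j₂ → AscentLeft r′ w j₁ j₂ ⇔ AscentLeft r W (↑ j₁) (↑ j₂)
      ascentLeft⇔ j₁ j₂ = order⇔ j₁ j₂ ×-⇔ left⇔ j₂ ×-⇔ value⇔ j₁ j₂

      ascentRight⇔ : ∀ j₁ j₂ → AscentRight r′ w j₁ j₂ ⇔ AscentRight r W (↑ j₁) (↑ j₂)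
      ascentRight⇔ j₁ j₂ = right⇔ j₁ ×-⇔ order⇔ j₁ j₂ ×-⇔ value⇔ j₁ j₂

      Avoiding-lower : Avoiding r W → Avoiding r′ w
      Avoiding-lower (perm , ¬3|12 , ¬23|1) =
        IsPerm-insertValue⁻ v i w perm ,
        (λ (j₁ , j₂ , j₃ , p) → ¬3|12 (↑ j₁ , ↑ j₂ , ↑ j₃ , pattern3|12⇔ j₁ j₂ j₃ .to p)) ,
        (λ (j₁ , j₂ , j₃ , p) → ¬23|1 (↑ j₁ , ↑ j₂ , ↑ j₃ , pattern23|1⇔ j₁ j₂ j₃ .to p))

      Avoiding-lift : Unused³ (Pattern3|12 r W) → Unused³ (Pattern23|1 r W) → Avoiding r′ w → Avoiding r W
      Avoiding-lift unused3|12 unused23|1 (perm , ¬3|12 , ¬23|1) =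
        IsPerm-insertValue v i w perm ,
        ¬∃³-lift (λ j₁ j₂ j₃ → pattern3|12⇔ j₁ j₂ j₃ .from) unused3|12 ¬3|12 ,
        ¬∃³-lift (λ j₁ j₂ j₃ → pattern23|1⇔ j₁ j₂ j₃ .from) unused23|1 ¬23|1

      DecreasingHalves-lower : DecreasingHalves r W → DecreasingHalves r′ w
      DecreasingHalves-lower (perm , ¬left , ¬right) =
        IsPerm-insertValue⁻ v i w perm ,
        (λ (j₁ , j₂ , a) → ¬left (↑ j₁ , ↑ j₂ , ascentLeft⇔ j₁ j₂ .to a)) ,
        (λ (j₁ , j₂ , a) → ¬right (↑ j₁ , ↑ j₂ , ascentRight⇔ j₁ j₂ .to a))

      DecreasingHalves-lift : Unused² (AscentLeft r W) → Unused² (AscentRight r W) → DecreasingHalves r′ w → DecreasingHalves r W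
      DecreasingHalves-lift unusedLeft unusedRight (perm , ¬left , ¬right) =
        IsPerm-insertValue v i w perm ,
        ¬∃²-lift (λ j₁ j₂ → ascentLeft⇔ j₁ j₂ .from) unusedLeft ¬left ,
        ¬∃²-lift (λ j₁ j₂ → ascentRight⇔ j₁ j₂ .from) unusedRight ¬right

  -- Deleting an extreme value of a counted permutation

  module MinInsertion {m : ℕ} (i : Fin (suc m)) (w : Vec (Fin m) m) where
    open Insertion zero i w

    MinOnLeft⇔ : ∀ {r} → MinOnLeft r W ⇔ toℕ i < r
    MinOnLeft⇔ = mk⇔ (λ { (j , j<r , Wj≡0) → subst (λ x → toℕ x < _) (W-position j Wj≡0) j<r }) (λ i<r → i , i<r , W-at)

    ¬below-min : ∀ x → ¬ (W ! x < W ! i)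
    ¬below-min x x<i = n≮0 (subst (W ! x <_) W-at x<i)

    above-min : ∀ x → x ≢ i → W ! i < W ! x
    above-min x x≢i = subst (_< W ! x) (sym W-at) (n≢0⇒n>0 (λ Wx≡0 → x≢i (W-position x Wx≡0)))

  module MaxInsertion {m : ℕ} (i : Fin (suc m)) (w : Vec (Fin m) m) where
    open Insertion (fromℕ m) i w

    W-at-max : W ! i ≡ m
    W-at-max = trans W-at (toℕ-fromℕ m)

    MaxOnRight⇔ : ∀ {r} → MaxOnRight r W ⇔ r ≤ toℕ i
    MaxOnRight⇔ = mk⇔ (λ { (j , r≤j , Wj≡m) → subst (λ x → _ ≤ toℕ x) (W-position j (trans (suc-injective Wj≡m) (sym (toℕ-fromℕ m)))) r≤j })
                      (λ r≤i → i , r≤i , cong suc W-at-max)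

    ¬above-max : ∀ x → ¬ (W ! i < W ! x)
    ¬above-max x i<x = <⇒≱ (subst (_< W ! x) W-at-max i<x) (s≤s⁻¹ (toℕ<n (lookup W x)))

    below-max : ∀ x → x ≢ i → W ! x < W ! i
    below-max x x≢i = subst (W ! x <_) (sym W-at-max)
      (≤∧≢⇒< (s≤s⁻¹ (toℕ<n (lookup W x))) (λ Wx≡m → x≢i (W-position x (trans Wx≡m (sym (toℕ-fromℕ m))))))

    W-↑-max : ∀ j → W ! ↑ j ≡ w ! j
    W-↑-max j = W-↑-below j (subst (toℕ (lookup w j) <_) (sym (toℕ-fromℕ m)) (toℕ<n (lookup w j)))

    module _ {r′ r : ℕ} (shift : BoundaryShift i r′ r) where

      ¬MinOnLeft-lower : ¬ MinOnLeft r W → ¬ MinOnLeft r′ w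
      ¬MinOnLeft-lower ¬min (j , j<r′ , wj≡0) = ¬min (↑ j , left⇔ shift j .to j<r′ , trans (W-↑-max j) wj≡0)

      ¬MinOnLeft-lift : (toℕ i < r → m ≢ 0) → ¬ MinOnLeft r′ w → ¬ MinOnLeft r W
      ¬MinOnLeft-lift i<r⇒m≢0 ¬min (j , j<r , Wj≡0) with j ≟ᶠ i
      ... | yes refl = i<r⇒m≢0 j<r (trans (sym W-at-max) Wj≡0)
      ... | no  j≢i  with punchIn-preimage j≢i
      ... | j′ , refl = ¬min (j′ , left⇔ shift j′ .from j<r , trans (sym (W-↑-max j′)) Wj≡0)

  toℕ-positive : {n : ℕ} {i : Fin (suc n)} → i ≢ zero → 0 < toℕ i
  toℕ-positive {i = zero}  i≢0 = contradiction refl i≢0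
  toℕ-positive {i = suc _} _   = z<s

  kMinRight : ℕ → ℕ → ℕ
  kMinRight r n = count (avoiding? r ∩? ∁? (minOnLeft? r)) (words n)

  kMinRightMaxLeft : ℕ → ℕ → ℕ
  kMinRightMaxLeft r n = count ((avoiding? r ∩? ∁? (minOnLeft? r)) ∩? ∁? (maxOnRight? r)) (words n)

  countDecreasingHalves : ℕ → ℕ → ℕ
  countDecreasingHalves r n = count (decreasingHalves? r) (words n)

  count-avoiding-minOnLeft : ∀ {a m} → a ≤ m →
                             count (avoiding? (suc a) ∩? minOnLeft? (suc a)) (words (suc m)) ≡ suc a * k a m
  count-avoiding-minOnLeft {a} {m} a≤m = begin
    count (avoiding? (suc a) ∩? minOnLeft? (suc a)) (words (suc m))
      ≡⟨ count-deleteValue zero (avoiding? (suc a) ∩? minOnLeft? (suc a)) (proj₁ ∘ proj₁) (λ i → toℕ i <? suc a) (avoiding? a)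
                           (λ i w → mk⇔ (decompose i w) (compose i w)) ⟩
    count (λ i → toℕ i <? suc a) (allFin (suc m)) * count (avoiding? a) (words m)
      ≡⟨ cong₂ _*_ (count-allFin-< (s≤s a≤m)) (sym (k≡count-avoiding a m)) ⟩
    suc a * k a m ∎
    where
    module _ (i : Fin (suc m)) (w : Vec (Fin m) m) where
      open Insertion zero i w
      open MinInsertion i w

      decompose : Avoiding (suc a) W × MinOnLeft (suc a) W → toℕ i < suc a × Avoiding a w
      decompose (av , min) = i<r , Avoiding-lower (boundaryShift-left i a (s≤s⁻¹ i<r)) av
        where i<r = MinOnLeft⇔ .to min

      compose : toℕ i < suc a × Avoiding a w → Avoiding (suc a) W × MinOnLeft (suc a) W
      compose (i<r , av) = Avoiding-lift (boundaryShift-left i a (s≤s⁻¹ i<r)) unused3|12 unused23|1 av , MinOnLeft⇔ .from i<r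
        where
        unused3|12 : Unused³ (Pattern3|12 (suc a) W)
        unused3|12 j₁ j₂ j₃ (_ , r≤j₂ , j₂<j₃ , _ , W₃<W₁) =
          (λ { refl → ¬below-min j₃ W₃<W₁ }) , (λ { refl → <⇒≱ i<r r≤j₂ }) , (λ { refl → <⇒≱ i<r (≤-trans r≤j₂ (<⇒≤ j₂<j₃)) })
        unused23|1 : Unused³ (Pattern23|1 (suc a) W)
        unused23|1 j₁ j₂ j₃ (_ , _ , r≤j₃ , W₃<W₁ , W₁<W₂) =
          (λ { refl → ¬below-min j₃ W₃<W₁ }) , (λ { refl → ¬below-min j₁ W₁<W₂ }) , (λ { refl → <⇒≱ i<r r≤j₃ })

  count-kMinRight-maxOnRight : ∀ {a m} → a ≤ suc m →
                               count ((avoiding? a ∩? ∁? (minOnLeft? a)) ∩? maxOnRight? a) (words (suc m)) ≡ (suc m ∸ a) * kMinRight a m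
  count-kMinRight-maxOnRight {a} {m} a≤1+m = begin
    count ((avoiding? a ∩? ∁? (minOnLeft? a)) ∩? maxOnRight? a) (words (suc m))
      ≡⟨ count-deleteValue (fromℕ m) ((avoiding? a ∩? ∁? (minOnLeft? a)) ∩? maxOnRight? a) (proj₁ ∘ proj₁ ∘ proj₁)
                           (λ i → a ≤? toℕ i) (avoiding? a ∩? ∁? (minOnLeft? a)) (λ i w → mk⇔ (decompose i w) (compose i w)) ⟩
    count (λ i → a ≤? toℕ i) (allFin (suc m)) * kMinRight a m
      ≡⟨ cong (_* kMinRight a m) (count-allFin-≥ a≤1+m) ⟩
    (suc m ∸ a) * kMinRight a m ∎
    where
    module _ (i : Fin (suc m)) (w : Vec (Fin m) m) where
      open Insertion (fromℕ m) i w
      open MaxInsertion i w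

      decompose : (Avoiding a W × ¬ MinOnLeft a W) × MaxOnRight a W → a ≤ toℕ i × Avoiding a w × ¬ MinOnLeft a w
      decompose ((av , ¬min) , max) = a≤i , Avoiding-lower shift av , ¬MinOnLeft-lower shift ¬min
        where
        a≤i = MaxOnRight⇔ .to max
        shift = boundaryShift-right i a a≤i

      compose : a ≤ toℕ i × Avoiding a w × ¬ MinOnLeft a w → (Avoiding a W × ¬ MinOnLeft a W) × MaxOnRight a W
      compose (a≤i , av , ¬min) =
        (Avoiding-lift shift unused3|12 unused23|1 av , ¬MinOnLeft-lift shift (λ i<a → contradiction a≤i (<⇒≱ i<a)) ¬min) ,
        MaxOnRight⇔ .from a≤i
        where
        shift = boundaryShift-right i a a≤i
        unused3|12 : Unused³ (Pattern3|12 a W)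
        unused3|12 j₁ j₂ j₃ (j₁<a , _ , _ , W₂<W₃ , W₃<W₁) =
          (λ { refl → <⇒≱ j₁<a a≤i }) , (λ { refl → ¬above-max j₃ W₂<W₃ }) , (λ { refl → ¬above-max j₁ W₃<W₁ })
        unused23|1 : Unused³ (Pattern23|1 a W)
        unused23|1 j₁ j₂ j₃ (j₁<j₂ , j₂<a , _ , W₃<W₁ , _) =
          (λ { refl → <⇒≱ (<-trans j₁<j₂ j₂<a) a≤i }) , (λ { refl → <⇒≱ j₂<a a≤i }) , (λ { refl → ¬above-max j₁ W₃<W₁ })

  -- Every entry left of the boundary exceeds the minimum z, which lies to the right: so an ascent
  -- on the left completes a 23|1 with z, an ascent on the right a 3|12 with the maximum, and the
  -- maximum is the first entry.
  module MaxLeft {p m : ℕ} (p<m : p < m) (i : Fin (suc m)) (w : Vec (Fin m) m) where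
    open Insertion (fromℕ m) i w
    open MaxInsertion i w

    decompose : (Avoiding (suc p) W × ¬ MinOnLeft (suc p) W) × ¬ MaxOnRight (suc p) W →
                i ≡ zero × DecreasingHalves p w × ¬ MinOnLeft p w
    decompose (((perm , ¬3|12 , ¬23|1) , ¬min) , ¬max) =
      i≡0 , (IsPerm-insertValue⁻ (fromℕ m) i w perm , ¬ascentLeft , ¬ascentRight) , ¬MinOnLeft-lower shift ¬min
      where
      i<r : toℕ i < suc p
      i<r = ≰⇒> (¬max ∘ MaxOnRight⇔ .from)
      shift = boundaryShift-left i p (s≤s⁻¹ i<r)
      z = proj₁ (IsPerm-surjective W perm zero)
      Wz≡0 : W ! z ≡ 0
      Wz≡0 = cong toℕ (proj₂ (IsPerm-surjective W perm zero))
      r≤z : suc p ≤ toℕ z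
      r≤z = ≮⇒≥ (λ z<r → ¬min (z , z<r , Wz≡0))
      W₀<W : ∀ x → toℕ x < suc p → W ! z < W ! x
      W₀<W x x<r = subst (_< W ! x) (sym Wz≡0) (n≢0⇒n>0 (λ Wx≡0 →
        <⇒≱ x<r (subst (λ y → suc p ≤ toℕ y) (perm z x (toℕ-injective (trans Wz≡0 (sym Wx≡0)))) r≤z)))
      i≡0 : i ≡ zero
      i≡0 with i ≟ᶠ zero
      ... | yes i≡0 = i≡0
      ... | no  i≢0 = contradiction (zero , i , z , toℕ-positive i≢0 , i<r , r≤z , W₀<W zero z<s , below-max zero (i≢0 ∘ sym)) ¬23|1
      ¬ascentLeft : ¬ ∃₂ (AscentLeft p w)
      ¬ascentLeft (j₁ , j₂ , asc) with ascentLeft⇔ shift j₁ j₂ .to asc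
      ... | ↑j₁<↑j₂ , ↑j₂<r , W₁<W₂ =
        ¬23|1 (↑ j₁ , ↑ j₂ , z , ↑j₁<↑j₂ , ↑j₂<r , r≤z , W₀<W (↑ j₁) (<-trans ↑j₁<↑j₂ ↑j₂<r) , W₁<W₂)
      ¬ascentRight : ¬ ∃₂ (AscentRight p w)
      ¬ascentRight (j₁ , j₂ , asc) with ascentRight⇔ shift j₁ j₂ .to asc
      ... | r≤↑j₁ , ↑j₁<↑j₂ , W₁<W₂ =
        ¬3|12 (i , ↑ j₁ , ↑ j₂ , i<r , r≤↑j₁ , ↑j₁<↑j₂ , W₁<W₂ , below-max (↑ j₂) (punchInᵢ≢i i j₂))

    compose : i ≡ zero × DecreasingHalves p w × ¬ MinOnLeft p w →
              (Avoiding (suc p) W × ¬ MinOnLeft (suc p) W) × ¬ MaxOnRight (suc p) W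
    compose (refl , (perm , ¬ascentLeft , ¬ascentRight) , ¬min) =
      ((IsPerm-insertValue (fromℕ m) zero w perm , ¬3|12 , ¬23|1) , ¬MinOnLeft-lift shift (λ _ m≡0 → <⇒≱ p<m (subst (_≤ p) (sym m≡0) z≤n)) ¬min) ,
      (λ max → <⇒≱ z<s (MaxOnRight⇔ .to max))
      where
      shift = boundaryShift-left zero p z≤n
      ¬3|12 : ¬ Occurs3|12 (suc p) W
      ¬3|12 (j₁ , j₂ , j₃ , _ , r≤j₂ , j₂<j₃ , W₂<W₃ , _)
        with punchIn-preimage {i = zero} {j = j₂} (λ { refl → <⇒≱ z<s r≤j₂ }) | punchIn-preimage {i = zero} {j = j₃} (λ { refl → n≮0 j₂<j₃ })
      ... | k₂ , refl | k₃ , refl = ¬ascentRight (k₂ , k₃ , ascentRight⇔ shift k₂ k₃ .from (r≤j₂ , j₂<j₃ , W₂<W₃))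
      ¬23|1 : ¬ Occurs23|1 (suc p) W
      ¬23|1 (j₁ , j₂ , j₃ , j₁<j₂ , j₂<r , _ , _ , W₁<W₂)
        with punchIn-preimage {i = zero} {j = j₁} (λ { refl → ¬above-max j₂ W₁<W₂ }) | punchIn-preimage {i = zero} {j = j₂} (λ { refl → n≮0 j₁<j₂ })
      ... | k₁ , refl | k₂ , refl = ¬ascentLeft (k₁ , k₂ , ascentLeft⇔ shift k₁ k₂ .from (j₁<j₂ , j₂<r , W₁<W₂))

  kMinRightMaxLeft-suc : ∀ {p m} → p < m → kMinRightMaxLeft (suc p) (suc m) ≡ count (decreasingHalves? p ∩? ∁? (minOnLeft? p)) (words m)
  kMinRightMaxLeft-suc {p} {m} p<m =
    count-deleteValue-at (fromℕ m) ((avoiding? (suc p) ∩? ∁? (minOnLeft? (suc p))) ∩? ∁? (maxOnRight? (suc p))) (proj₁ ∘ proj₁ ∘ proj₁)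
                         zero (decreasingHalves? p ∩? ∁? (minOnLeft? p)) (λ i w → mk⇔ (MaxLeft.decompose p<m i w) (MaxLeft.compose p<m i w))

  module MinLast {p m : ℕ} (p≤m : p ≤ m) (i : Fin (suc m)) (w : Vec (Fin m) m) where
    open Insertion zero i w
    open MinInsertion i w

    decompose : DecreasingHalves p W × ¬ MinOnLeft p W → i ≡ fromℕ m × DecreasingHalves p w
    decompose (dh@(_ , _ , ¬ascentRight) , ¬min) = i≡m , DecreasingHalves-lower (boundaryShift-right i p p≤i) dh
      where
      p≤i = ≮⇒≥ (¬min ∘ MinOnLeft⇔ .from)
      i≡m : i ≡ fromℕ m
      i≡m with i ≟ᶠ fromℕ m
      ... | yes i≡m = i≡m
      ... | no  i≢m = contradiction (i , fromℕ m , p≤i , Fin.≤∧≢⇒< (≤fromℕ i) i≢m , above-min (fromℕ m) (i≢m ∘ sym)) ¬ascentRight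

    compose : i ≡ fromℕ m × DecreasingHalves p w → DecreasingHalves p W × ¬ MinOnLeft p W
    compose (refl , dh) = DecreasingHalves-lift shift unusedLeft unusedRight dh , λ min → <⇒≱ (MinOnLeft⇔ .to min) p≤i
      where
      p≤i = subst (p ≤_) (sym (toℕ-fromℕ m)) p≤m
      shift = boundaryShift-right (fromℕ m) p p≤i
      unusedLeft : Unused² (AscentLeft p W)
      unusedLeft j₁ j₂ (j₁<j₂ , j₂<p , _) = (λ { refl → <⇒≱ (<-trans j₁<j₂ j₂<p) p≤i }) , (λ { refl → <⇒≱ j₂<p p≤i })
      unusedRight : Unused² (AscentRight p W)
      unusedRight j₁ j₂ (_ , j₁<j₂ , W₁<W₂) = (λ { refl → <⇒≱ j₁<j₂ (≤fromℕ j₂) }) , (λ { refl → ¬below-min j₁ W₁<W₂ })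

  count-decreasingHalves-minRight : ∀ {p m} → p ≤ m →
                                    count (decreasingHalves? p ∩? ∁? (minOnLeft? p)) (words (suc m)) ≡ countDecreasingHalves p m
  count-decreasingHalves-minRight {p} {m} p≤m =
    count-deleteValue-at zero (decreasingHalves? p ∩? ∁? (minOnLeft? p)) (proj₁ ∘ proj₁) (fromℕ m) (decreasingHalves? p)
                         (λ i w → mk⇔ (MinLast.decompose p≤m i w) (MinLast.compose p≤m i w))

  module MaxAtBoundary {p m : ℕ} (p≤m : p ≤ m) (i : Fin (suc m)) (w : Vec (Fin m) m) where
    open Insertion (fromℕ m) i w
    open MaxInsertion i w

    c : Fin (suc m)
    c = fromℕ< (s≤s p≤m)

    p≤c : p ≤ toℕ c
    p≤c = ≤-reflexive (sym (toℕ-fromℕ< (s≤s p≤m)))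

    decompose : DecreasingHalves p W × MaxOnRight p W → i ≡ c × DecreasingHalves p w
    decompose (dh@(_ , _ , ¬ascentRight) , max) = i≡c , DecreasingHalves-lower (boundaryShift-right i p p≤i) dh
      where
      p≤i = MaxOnRight⇔ .to max
      i≡c : i ≡ c
      i≡c with i ≟ᶠ c
      ... | yes i≡c = i≡c
      ... | no  i≢c = contradiction (c , i , p≤c , c<i , below-max c (i≢c ∘ sym)) ¬ascentRight
        where c<i = ≤∧≢⇒< (subst (_≤ toℕ i) (sym (toℕ-fromℕ< (s≤s p≤m))) p≤i) (λ c≡i → i≢c (toℕ-injective (sym c≡i)))

    compose : i ≡ c × DecreasingHalves p w → DecreasingHalves p W × MaxOnRight p W
    compose (refl , dh) = DecreasingHalves-lift (boundaryShift-right c p p≤c) unusedLeft unusedRight dh , MaxOnRight⇔ .from p≤c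
      where
      unusedLeft : Unused² (AscentLeft p W)
      unusedLeft j₁ j₂ (j₁<j₂ , j₂<p , _) = (λ { refl → <⇒≱ (<-trans j₁<j₂ j₂<p) p≤c }) , (λ { refl → <⇒≱ j₂<p p≤c })
      unusedRight : Unused² (AscentRight p W)
      unusedRight j₁ j₂ (p≤j₁ , j₁<j₂ , W₁<W₂) =
        (λ { refl → ¬above-max j₂ W₁<W₂ }) , (λ { refl → <⇒≱ j₁<j₂ (subst (_≤ toℕ j₁) (sym (toℕ-fromℕ< (s≤s p≤m))) p≤j₁) })

  count-decreasingHalves-maxOnRight : ∀ {p m} → p ≤ m →
                                      count (decreasingHalves? p ∩? maxOnRight? p) (words (suc m)) ≡ countDecreasingHalves p m
  count-decreasingHalves-maxOnRight {p} {m} p≤m =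
    count-deleteValue-at (fromℕ m) (decreasingHalves? p ∩? maxOnRight? p) (proj₁ ∘ proj₁) (fromℕ< (s≤s p≤m)) (decreasingHalves? p)
                         (λ i w → mk⇔ (MaxAtBoundary.decompose p≤m i w) (MaxAtBoundary.compose p≤m i w))

  module MaxFirst {p m : ℕ} (i : Fin (suc m)) (w : Vec (Fin m) m) where
    open Insertion (fromℕ m) i w
    open MaxInsertion i w

    decompose : DecreasingHalves (suc p) W × ¬ MaxOnRight (suc p) W → i ≡ zero × DecreasingHalves p w
    decompose (dh@(_ , ¬ascentLeft , _) , ¬max) = i≡0 , DecreasingHalves-lower (boundaryShift-left i p (s≤s⁻¹ i<r)) dh
      where
      i<r : toℕ i < suc p
      i<r = ≰⇒> (¬max ∘ MaxOnRight⇔ .from)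
      i≡0 : i ≡ zero
      i≡0 with i ≟ᶠ zero
      ... | yes i≡0 = i≡0
      ... | no  i≢0 = contradiction (zero , i , toℕ-positive i≢0 , i<r , below-max zero (i≢0 ∘ sym)) ¬ascentLeft

    compose : i ≡ zero × DecreasingHalves p w → DecreasingHalves (suc p) W × ¬ MaxOnRight (suc p) W
    compose (refl , dh) = DecreasingHalves-lift (boundaryShift-left zero p z≤n) unusedLeft unusedRight dh , λ max → <⇒≱ z<s (MaxOnRight⇔ .to max)
      where
      unusedLeft : Unused² (AscentLeft (suc p) W)
      unusedLeft j₁ j₂ (j₁<j₂ , _ , W₁<W₂) = (λ { refl → ¬above-max j₂ W₁<W₂ }) , (λ { refl → n≮0 j₁<j₂ })
      unusedRight : Unused² (AscentRight (suc p) W)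
      unusedRight j₁ j₂ (r≤j₁ , j₁<j₂ , _) = (λ { refl → <⇒≱ z<s r≤j₁ }) , (λ { refl → n≮0 j₁<j₂ })

  count-decreasingHalves-maxLeft : ∀ p m →
                                   count (decreasingHalves? (suc p) ∩? ∁? (maxOnRight? (suc p))) (words (suc m)) ≡ countDecreasingHalves p m
  count-decreasingHalves-maxLeft p m =
    count-deleteValue-at (fromℕ m) (decreasingHalves? (suc p) ∩? ∁? (maxOnRight? (suc p))) (proj₁ ∘ proj₁) zero (decreasingHalves? p)
                         (λ i w → mk⇔ (MaxFirst.decompose i w) (MaxFirst.compose i w))

  k≡minOnLeft+kMinRight : ∀ r n → k r n ≡ count (avoiding? r ∩? minOnLeft? r) (words n) + kMinRight r n
  k≡minOnLeft+kMinRight r n = trans (k≡count-avoiding r n) (count-split (avoiding? r) (minOnLeft? r) (words n))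

  kMinRight≡maxOnRight+kMinRightMaxLeft : ∀ r n → kMinRight r n ≡ count ((avoiding? r ∩? ∁? (minOnLeft? r)) ∩? maxOnRight? r) (words n) + kMinRightMaxLeft r n
  kMinRight≡maxOnRight+kMinRightMaxLeft r n = count-split (avoiding? r ∩? ∁? (minOnLeft? r)) (maxOnRight? r) (words n)

  k-zero : ∀ n → k 0 n ≡ kMinRight 0 n
  k-zero n = trans (k≡minOnLeft+kMinRight 0 n) (cong (_+ kMinRight 0 n) (count-none (avoiding? 0 ∩? minOnLeft? 0) (words n) λ { _ (_ , _ , () , _) }))

  k-suc : ∀ {a m} → a ≤ m → k (suc a) (suc m) ≡ suc a * k a m + kMinRight (suc a) (suc m)
  k-suc {a} {m} a≤m = trans (k≡minOnLeft+kMinRight (suc a) (suc m)) (cong (_+ kMinRight (suc a) (suc m)) (count-avoiding-minOnLeft a≤m))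

  kMinRight-suc : ∀ {a m} → a ≤ suc m → kMinRight a (suc m) ≡ (suc m ∸ a) * kMinRight a m + kMinRightMaxLeft a (suc m)
  kMinRight-suc {a} {m} a≤1+m = trans (kMinRight≡maxOnRight+kMinRightMaxLeft a (suc m)) (cong (_+ kMinRightMaxLeft a (suc m)) (count-kMinRight-maxOnRight a≤1+m))

  -- Recurrences

  IsPerm⇒MinOnLeft : (w : Vec (Fin (suc m)) (suc m)) → IsPerm w → MinOnLeft (suc m) w
  IsPerm⇒MinOnLeft w perm = let z , wz≡0 = IsPerm-surjective w perm zero in z , toℕ<n z , cong toℕ wz≡0

  IsPerm⇒MaxOnRight : (w : Vec (Fin (suc m)) (suc m)) → IsPerm w → MaxOnRight 0 w
  IsPerm⇒MaxOnRight {m} w perm = let j , wj≡m = IsPerm-surjective w perm (fromℕ m) in j , z≤n , cong suc (trans (cong toℕ wj≡m) (toℕ-fromℕ m))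

  kMinRight-diagonal : ∀ m → kMinRight (suc m) (suc m) ≡ 0
  kMinRight-diagonal m = count-none (avoiding? (suc m) ∩? ∁? (minOnLeft? (suc m))) (words (suc m)) λ w ((perm , _) , ¬min) → ¬min (IsPerm⇒MinOnLeft w perm)

  kMinRightMaxLeft-zero : ∀ m → kMinRightMaxLeft 0 (suc m) ≡ 0
  kMinRightMaxLeft-zero m = count-none ((avoiding? 0 ∩? ∁? (minOnLeft? 0)) ∩? ∁? (maxOnRight? 0)) (words (suc m))
    λ w (((perm , _) , _) , ¬max) → ¬max (IsPerm⇒MaxOnRight w perm)

  decreasingHalves-maxOnRight-diagonal : ∀ m → count (decreasingHalves? (suc m) ∩? maxOnRight? (suc m)) (words (suc m)) ≡ 0
  decreasingHalves-maxOnRight-diagonal m =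
    count-none (decreasingHalves? (suc m) ∩? maxOnRight? (suc m)) (words (suc m)) λ _ (_ , j , r≤j , _) → <⇒≱ (toℕ<n j) r≤j

  decreasingHalves-maxLeft-zero : ∀ m → count (decreasingHalves? 0 ∩? ∁? (maxOnRight? 0)) (words (suc m)) ≡ 0
  decreasingHalves-maxLeft-zero m = count-none (decreasingHalves? 0 ∩? ∁? (maxOnRight? 0)) (words (suc m))
    λ w ((perm , _) , ¬max) → ¬max (IsPerm⇒MaxOnRight w perm)

  countDecreasingHalves-suc : ∀ p m → countDecreasingHalves p (suc m) ≡
    count (decreasingHalves? p ∩? maxOnRight? p) (words (suc m)) + count (decreasingHalves? p ∩? ∁? (maxOnRight? p)) (words (suc m))
  countDecreasingHalves-suc p m = count-split (decreasingHalves? p) (maxOnRight? p) (words (suc m))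

  countDecreasingHalves-diagonal : ∀ p → countDecreasingHalves p p ≡ 1
  countDecreasingHalves-diagonal zero    = refl
  countDecreasingHalves-diagonal (suc p) = begin
    countDecreasingHalves (suc p) (suc p)   ≡⟨ countDecreasingHalves-suc (suc p) p ⟩
    _                                       ≡⟨ cong₂ _+_ (decreasingHalves-maxOnRight-diagonal p) (count-decreasingHalves-maxLeft p p) ⟩
    countDecreasingHalves p p               ≡⟨ countDecreasingHalves-diagonal p ⟩
    1                                       ∎

  countDecreasingHalves≡C : ∀ p q → countDecreasingHalves p (p + q) ≡ (p + q) C p
  countDecreasingHalves≡C zero    zero    = refl
  countDecreasingHalves≡C zero    (suc q) = begin
    countDecreasingHalves 0 (suc q)     ≡⟨ countDecreasingHalves-suc 0 q ⟩
    _                                   ≡⟨ cong₂ _+_ (count-decreasingHalves-maxOnRight {0} {q} z≤n) (decreasingHalves-maxLeft-zero q) ⟩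
    countDecreasingHalves 0 q + 0       ≡⟨ +-identityʳ _ ⟩
    countDecreasingHalves 0 q           ≡⟨ countDecreasingHalves≡C zero q ⟩
    1                                   ∎
  countDecreasingHalves≡C (suc p) zero    = begin
    countDecreasingHalves (suc p) (suc p + 0) ≡⟨ cong (countDecreasingHalves (suc p)) (+-identityʳ (suc p)) ⟩
    countDecreasingHalves (suc p) (suc p)     ≡⟨ countDecreasingHalves-diagonal (suc p) ⟩
    1                                         ≡⟨ nCn≡1 (suc p) ⟨
    suc p C suc p                             ≡⟨ cong (_C suc p) (+-identityʳ (suc p)) ⟨
    (suc p + 0) C suc p                       ∎
  countDecreasingHalves≡C (suc p) (suc q) = begin
    countDecreasingHalves (suc p) (suc N)                  ≡⟨ countDecreasingHalves-suc (suc p) N ⟩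
    _                                                      ≡⟨ cong₂ _+_ (count-decreasingHalves-maxOnRight 1+p≤N) (count-decreasingHalves-maxLeft p N) ⟩
    countDecreasingHalves (suc p) N + countDecreasingHalves p N
      ≡⟨ cong₂ _+_ (trans (cong (countDecreasingHalves (suc p)) (+-suc p q)) (countDecreasingHalves≡C (suc p) q)) (countDecreasingHalves≡C p (suc q)) ⟩
    (suc p + q) C suc p + N C p                            ≡⟨ cong (λ n → n C suc p + N C p) (+-suc p q) ⟨
    N C suc p + N C p                                      ≡⟨ +-comm (N C suc p) (N C p) ⟩
    N C p + N C suc p                                      ≡⟨ nCk+nC[k+1]≡[n+1]C[k+1] N p ⟩
    suc N C suc p                                          ∎
    where
    N = p + suc q
    1+p≤N : suc p ≤ N
    1+p≤N = subst (suc p ≤_) (sym (+-suc p q)) (s≤s (m≤m+n p q))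

  K : ℕ → ℕ → ℕ
  K a b = k a (a + b)

  K-zero-suc : ∀ b → K 0 (suc b) ≡ suc b * K 0 b
  K-zero-suc b = begin
    k 0 (suc b)                                  ≡⟨ k-zero (suc b) ⟩
    kMinRight 0 (suc b)                          ≡⟨ kMinRight-suc {0} {b} z≤n ⟩
    suc b * kMinRight 0 b + kMinRightMaxLeft 0 (suc b) ≡⟨ cong₂ _+_ (cong (suc b *_) (sym (k-zero b))) (kMinRightMaxLeft-zero b) ⟩
    suc b * k 0 b + 0                            ≡⟨ +-identityʳ _ ⟩
    suc b * k 0 b                                ∎

  K-suc-zero : ∀ a → K (suc a) 0 ≡ suc a * K a 0
  K-suc-zero a = begin
    k (suc a) (suc (a + 0))                            ≡⟨ k-suc (m≤m+n a 0) ⟩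
    suc a * K a 0 + kMinRight (suc a) (suc (a + 0))    ≡⟨ cong (λ n → suc a * K a 0 + kMinRight (suc a) (suc n)) (+-identityʳ a) ⟩
    suc a * K a 0 + kMinRight (suc a) (suc a)          ≡⟨ cong (suc a * K a 0 +_) (kMinRight-diagonal a) ⟩
    suc a * K a 0 + 0                                  ≡⟨ +-identityʳ _ ⟩
    suc a * K a 0                                      ∎

  kMinRightMaxLeft≡C : ∀ a b → kMinRightMaxLeft (suc a) (suc (suc (a + b))) ≡ (a + b) C a
  kMinRightMaxLeft≡C a b = begin
    kMinRightMaxLeft (suc a) (suc (suc (a + b)))                         ≡⟨ kMinRightMaxLeft-suc (s≤s (m≤m+n a b)) ⟩
    count (decreasingHalves? a ∩? ∁? (minOnLeft? a)) (words (suc (a + b))) ≡⟨ count-decreasingHalves-minRight (m≤m+n a b) ⟩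
    countDecreasingHalves a (a + b)                                      ≡⟨ countDecreasingHalves≡C a b ⟩
    (a + b) C a                                                          ∎

  K-suc-suc : ∀ a b → K (suc a) (suc b) + K a b * (suc a * suc b) ≡ K a (suc b) * suc a + K (suc a) b * suc b + (a + b) C a
  K-suc-suc a b = begin
    K A B + K a b * (A * B)                   ≡⟨ cong (_+ K a b * (A * B)) K-AB ⟩
    A * K a B + (B * H + V) + K a b * (A * B) ≡⟨ solve 6 (λ A B KaB Kab H V → A :* KaB :+ (B :* H :+ V) :+ Kab :* (A :* B) := KaB :* A :+ (A :* Kab :+ H) :* B :+ V)
                                                     refl A B (K a B) (K a b) H V ⟩
    K a B * A + (A * K a b + H) * B + V       ≡⟨ cong (λ x → K a B * A + x * B + V) (k-suc (m≤m+n a b)) ⟨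
    K a B * A + K A b * B + V                 ∎
    where
    open +-*-Solver
    A = suc a
    B = suc b
    M = suc (a + b)
    H = kMinRight A M
    V = (a + b) C a
    M≡ : a + B ≡ M
    M≡ = +-suc a b
    K-AB : K A B ≡ A * K a B + (B * H + V)
    K-AB = begin
      k A (suc (a + B))                                ≡⟨ k-suc (m≤m+n a B) ⟩
      A * K a B + kMinRight A (suc (a + B))            ≡⟨ cong (λ n → A * K a B + kMinRight A (suc n)) M≡ ⟩
      A * K a B + kMinRight A (suc M)                  ≡⟨ cong (A * K a B +_) (kMinRight-suc (s≤s (m≤n⇒m≤1+n (m≤m+n a b)))) ⟩
      A * K a B + ((suc M ∸ A) * H + kMinRightMaxLeft A (suc M))
        ≡⟨ cong (λ x → A * K a B + (x * H + kMinRightMaxLeft A (suc M))) (trans (cong (_∸ a) (sym M≡)) (m+n∸m≡n a B)) ⟩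
      A * K a B + (B * H + kMinRightMaxLeft A (suc M)) ≡⟨ cong (λ x → A * K a B + (B * H + x)) (kMinRightMaxLeft≡C a b) ⟩
      A * K a B + (B * H + V)                          ∎

module PowerSeries where

  open Permutations using (K; K-zero-suc; K-suc-zero; K-suc-suc)
  import Data.Integer as ℤ
  import Data.Integer.Properties as ℤ
  open import Data.List using (map; upTo; applyUpTo)
  open import Data.Nat as ℕ using (ℕ; zero; suc; _∸_; _!; _≤_; _<_; _≤?_; _≟_; z≤n; s≤s; NonZero)
  import Data.Nat.Properties as ℕ
  open import Data.Nat.Properties using (_!*_!≢0)
  open import Data.Nat.Combinatorics using (_C_; nCk≡n!/k![n-k]!; k![n∸k]!∣n!; k>n⇒nCk≡0; nCk+nC[k+1]≡[n+1]C[k+1])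
  open import Data.Nat.DivMod using (m/n*n≡m)
  open import Data.Nat.Solver using () renaming (module +-*-Solver to ℕ-Solver)
  open import Data.Rational using (ℚ; 0ℚ; 1ℚ; _+_; _*_; _-_; _/_; fromℚᵘ)
  import Data.Rational.Properties as ℚ
  open import Data.Rational.Solver using (module +-*-Solver)
  open import Data.Rational.Unnormalised as ℚᵘ using (mkℚᵘ; *≡*)
  import Data.Rational.Unnormalised.Properties as ℚᵘ
  open import Relation.Nullary using (yes; no; contradiction)
  open import Relation.Nullary.Decidable using (dec-true; dec-false)

  fromℚᵘ-+ : ∀ p q → fromℚᵘ (p ℚᵘ.+ q) ≡ fromℚᵘ p + fromℚᵘ q
  fromℚᵘ-+ p q = trans (ℚ.fromℚᵘ-cong (ℚᵘ.≃-sym p+q≃)) (ℚ.fromℚᵘ-toℚᵘ _)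
    where p+q≃ = ℚᵘ.≃-trans (ℚ.toℚᵘ-homo-+ (fromℚᵘ p) (fromℚᵘ q)) (ℚᵘ.+-cong (ℚ.toℚᵘ-fromℚᵘ p) (ℚ.toℚᵘ-fromℚᵘ q))

  fromℚᵘ-* : ∀ p q → fromℚᵘ (p ℚᵘ.* q) ≡ fromℚᵘ p * fromℚᵘ q
  fromℚᵘ-* p q = trans (ℚ.fromℚᵘ-cong (ℚᵘ.≃-sym p*q≃)) (ℚ.fromℚᵘ-toℚᵘ _)
    where p*q≃ = ℚᵘ.≃-trans (ℚ.toℚᵘ-homo-* (fromℚᵘ p) (fromℚᵘ q)) (ℚᵘ.*-cong (ℚ.toℚᵘ-fromℚᵘ p) (ℚ.toℚᵘ-fromℚᵘ q))

  ℕtoℚ-+ : ∀ m n → ℕtoℚ (m ℕ.+ n) ≡ ℕtoℚ m + ℕtoℚ n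
  ℕtoℚ-+ m n = trans (ℚ.fromℚᵘ-cong {mkℚᵘ (ℤ.+ (m ℕ.+ n)) 0} {mkℚᵘ (ℤ.+ m) 0 ℚᵘ.+ mkℚᵘ (ℤ.+ n) 0} (*≡* (cong (ℤ._* ℤ.1ℤ) m+n≡)))
                     (fromℚᵘ-+ (mkℚᵘ (ℤ.+ m) 0) (mkℚᵘ (ℤ.+ n) 0))
    where
    m+n≡ : ℤ.+ (m ℕ.+ n) ≡ ℤ.+ m ℤ.* ℤ.1ℤ ℤ.+ ℤ.+ n ℤ.* ℤ.1ℤ
    m+n≡ = trans (ℤ.pos-+ m n) (sym (cong₂ ℤ._+_ (ℤ.*-identityʳ (ℤ.+ m)) (ℤ.*-identityʳ (ℤ.+ n))))

  ℕtoℚ-* : ∀ m n → ℕtoℚ (m ℕ.* n) ≡ ℕtoℚ m * ℕtoℚ n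
  ℕtoℚ-* m n = trans (ℚ.fromℚᵘ-cong {mkℚᵘ (ℤ.+ (m ℕ.* n)) 0} {mkℚᵘ (ℤ.+ m) 0 ℚᵘ.* mkℚᵘ (ℤ.+ n) 0}
                                     (*≡* (cong (ℤ._* ℤ.1ℤ) (ℤ.pos-* m n))))
                     (fromℚᵘ-* (mkℚᵘ (ℤ.+ m) 0) (mkℚᵘ (ℤ.+ n) 0))

  /-*-cancel : ∀ m d .{{_ : NonZero d}} → (ℤ.+ m) / d * ℕtoℚ d ≡ ℕtoℚ m
  /-*-cancel m (suc d) = trans (sym (fromℚᵘ-* (mkℚᵘ (ℤ.+ m) d) (mkℚᵘ (ℤ.+ suc d) 0)))
                               (ℚ.fromℚᵘ-cong {mkℚᵘ (ℤ.+ m) d ℚᵘ.* mkℚᵘ (ℤ.+ suc d) 0} {mkℚᵘ (ℤ.+ m) 0} (*≡* m*d≡))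
    where
    m*d≡ : ℤ.+ m ℤ.* ℤ.+ suc d ℤ.* ℤ.1ℤ ≡ ℤ.+ m ℤ.* ℤ.+ (suc d ℕ.* 1)
    m*d≡ = trans (ℤ.*-identityʳ _) (cong (ℤ.+ m ℤ.*_) (cong ℤ.+_ (sym (ℕ.*-identityʳ (suc d)))))

  *-cancelʳ-ℕtoℚ : ∀ d .{{_ : NonZero d}} {x y : ℚ} → x * ℕtoℚ d ≡ y * ℕtoℚ d → x ≡ y
  *-cancelʳ-ℕtoℚ d {x} {y} eq = begin
    x                          ≡⟨ ℚ.*-identityʳ x ⟨
    x * 1ℚ                     ≡⟨ cong (x *_) (/-*-cancel 1 d) ⟨
    x * (d⁻¹ * ℕtoℚ d)         ≡⟨ solve 3 (λ x u n → x :* (u :* n) := (x :* n) :* u) refl x d⁻¹ (ℕtoℚ d) ⟩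
    x * ℕtoℚ d * d⁻¹           ≡⟨ cong (_* d⁻¹) eq ⟩
    y * ℕtoℚ d * d⁻¹           ≡⟨ solve 3 (λ x u n → (x :* n) :* u := x :* (u :* n)) refl y d⁻¹ (ℕtoℚ d) ⟩
    y * (d⁻¹ * ℕtoℚ d)         ≡⟨ cong (y *_) (/-*-cancel 1 d) ⟩
    y * 1ℚ                     ≡⟨ ℚ.*-identityʳ y ⟩
    y                          ∎
    where
    open +-*-Solver
    d⁻¹ = (ℤ.+ 1) / d

  ∑< : ℕ → (ℕ → ℚ) → ℚ
  ∑< zero    f = 0ℚ
  ∑< (suc n) f = f 0 + ∑< n (f ∘ suc)

  syntax ∑< n (λ i → e) = ∑[ i < n ] e

  ∑-cong : ∀ n {f g : ℕ → ℚ} → (∀ i → i ℕ.< n → f i ≡ g i) → ∑< n f ≡ ∑< n g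
  ∑-cong zero    f≡g = refl
  ∑-cong (suc n) f≡g = cong₂ _+_ (f≡g 0 (s≤s z≤n)) (∑-cong n (λ i i<n → f≡g (suc i) (s≤s i<n)))

  ∑-zero : ∀ n {f : ℕ → ℚ} → (∀ i → i ℕ.< n → f i ≡ 0ℚ) → ∑< n f ≡ 0ℚ
  ∑-zero zero    f≡0 = refl
  ∑-zero (suc n) f≡0 = cong₂ _+_ (f≡0 0 (s≤s z≤n)) (∑-zero n (λ i i<n → f≡0 (suc i) (s≤s i<n)))

  ∑-single : ∀ n {f : ℕ → ℚ} i₀ → i₀ ℕ.< n → (∀ i → i ℕ.< n → i ≢ i₀ → f i ≡ 0ℚ) → ∑< n f ≡ f i₀
  ∑-single (suc n) {f} zero     _          f≡0 = trans (cong (_+_ (f 0)) (∑-zero n (λ i i<n → f≡0 (suc i) (s≤s i<n) λ ()))) (ℚ.+-identityʳ (f 0))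
  ∑-single (suc n) {f} (suc i₀) (s≤s i₀<n) f≡0 =
    trans (cong₂ _+_ (f≡0 0 (s≤s z≤n) λ ()) (∑-single n i₀ i₀<n (λ i i<n i≢i₀ → f≡0 (suc i) (s≤s i<n) (i≢i₀ ∘ ℕ.suc-injective))))
          (ℚ.+-identityˡ (f (suc i₀)))

  ∑-+ : ∀ n (f g : ℕ → ℚ) → ∑[ i < n ] (f i + g i) ≡ ∑< n f + ∑< n g
  ∑-+ zero    f g = refl
  ∑-+ (suc n) f g = trans (cong (_+_ (f 0 + g 0)) (∑-+ n (f ∘ suc) (g ∘ suc)))
                          (solve 4 (λ a b c d → a :+ b :+ (c :+ d) := a :+ c :+ (b :+ d)) refl (f 0) (g 0) (∑< n (f ∘ suc)) (∑< n (g ∘ suc)))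
    where open +-*-Solver

  ∑-- : ∀ n (f g : ℕ → ℚ) → ∑[ i < n ] (f i - g i) ≡ ∑< n f - ∑< n g
  ∑-- zero    f g = refl
  ∑-- (suc n) f g = trans (cong (_+_ (f 0 - g 0)) (∑-- n (f ∘ suc) (g ∘ suc)))
                          (solve 4 (λ a b c d → a :- b :+ (c :- d) := a :+ c :- (b :+ d)) refl (f 0) (g 0) (∑< n (f ∘ suc)) (∑< n (g ∘ suc)))
    where open +-*-Solver

  ∑-*ʳ : ∀ n (f : ℕ → ℚ) x → ∑[ i < n ] (f i * x) ≡ ∑< n f * x
  ∑-*ʳ zero    f x = sym (ℚ.*-zeroˡ x)
  ∑-*ʳ (suc n) f x = trans (cong (_+_ (f 0 * x)) (∑-*ʳ n (f ∘ suc) x)) (sym (ℚ.*-distribʳ-+ x (f 0) (∑< n (f ∘ suc))))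

  sumℚ-upTo : ∀ n (f : ℕ → ℚ) → sumℚ (map f (upTo n)) ≡ ∑< n f
  sumℚ-upTo n f = go n (λ i → i)
    where
    go : ∀ n (g : ℕ → ℕ) → sumℚ (map f (applyUpTo g n)) ≡ ∑< n (f ∘ g)
    go zero    g = refl
    go (suc n) g = cong (_+_ (f (g 0))) (go n (g ∘ suc))

  ⊛-∑ : ∀ F G a b → (F ⊛ G) a b ≡ ∑[ i < suc a ] ∑[ j < suc b ] (F i j * G (a ∸ i) (b ∸ j))
  ⊛-∑ F G a b = trans (sumℚ-upTo (suc a) (λ i → sumℚ (map (λ j → F i j * G (a ∸ i) (b ∸ j)) (upTo (suc b)))))
                      (∑-cong (suc a) λ i _ → sumℚ-upTo (suc b) (λ j → F i j * G (a ∸ i) (b ∸ j)))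

  module _ (_∙_ : ℚ → ℚ → ℚ) (∑-∙ : ∀ n f g → ∑[ i < n ] (f i ∙ g i) ≡ ∑< n f ∙ ∑< n g)
           (*-distribˡ-∙ : ∀ x y z → x * (y ∙ z) ≡ (x * y) ∙ (x * z)) where

    ⊛-distribˡ : ∀ F G H a b → (F ⊛ (λ a′ b′ → G a′ b′ ∙ H a′ b′)) a b ≡ (F ⊛ G) a b ∙ (F ⊛ H) a b
    ⊛-distribˡ F G H a b = begin
      (F ⊛ (λ a′ b′ → G a′ b′ ∙ H a′ b′)) a b
        ≡⟨ ⊛-∑ F (λ a′ b′ → G a′ b′ ∙ H a′ b′) a b ⟩
      ∑[ i < suc a ] ∑[ j < suc b ] (F i j * (G (a ∸ i) (b ∸ j) ∙ H (a ∸ i) (b ∸ j)))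
        ≡⟨ ∑-cong (suc a) (λ i _ → trans (∑-cong (suc b) λ j _ → *-distribˡ-∙ (F i j) (G (a ∸ i) (b ∸ j)) (H (a ∸ i) (b ∸ j)))
                                         (∑-∙ (suc b) (FG i) (FH i))) ⟩
      ∑[ i < suc a ] (∑< (suc b) (FG i) ∙ ∑< (suc b) (FH i))
        ≡⟨ ∑-∙ (suc a) (λ i → ∑< (suc b) (FG i)) (λ i → ∑< (suc b) (FH i)) ⟩
      (∑[ i < suc a ] ∑< (suc b) (FG i)) ∙ (∑[ i < suc a ] ∑< (suc b) (FH i))
        ≡⟨ cong₂ _∙_ (⊛-∑ F G a b) (⊛-∑ F H a b) ⟨
      (F ⊛ G) a b ∙ (F ⊛ H) a b ∎
      where
      FG FH : ℕ → ℕ → ℚ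
      FG i j = F i j * G (a ∸ i) (b ∸ j)
      FH i j = F i j * H (a ∸ i) (b ∸ j)

  ⊛-⊕ʳ : ∀ F G H a b → (F ⊛ (G ⊕ H)) a b ≡ (F ⊛ G) a b + (F ⊛ H) a b
  ⊛-⊕ʳ = ⊛-distribˡ _+_ ∑-+ ℚ.*-distribˡ-+

  ⊛-⊖ʳ : ∀ F G H a b → (F ⊛ (G ⊖ H)) a b ≡ (F ⊛ G) a b - (F ⊛ H) a b
  ⊛-⊖ʳ = ⊛-distribˡ _-_ ∑-- (solve 3 (λ x y z → x :* (y :- z) := x :* y :- x :* z) refl)
    where open +-*-Solver

  record Monomial (u v : ℕ) (G : PS) : Set where
    field
      coeff-at : G u v ≡ 1ℚ
      coeff-offˣ : ∀ a b → a ≢ u → G a b ≡ 0ℚ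
      coeff-offʸ : ∀ a b → b ≢ v → G a b ≡ 0ℚ

  ∸-inverse : ∀ {a i u} → i ≤ a → a ∸ i ≡ u → i ≡ a ∸ u
  ∸-inverse {a} i≤a a∸i≡u = trans (sym (ℕ.m∸[m∸n]≡n i≤a)) (cong (a ∸_) a∸i≡u)

  module _ {u v : ℕ} {G : PS} (mono : Monomial u v G) (F : PS) where
    open Monomial mono

    ⊛-monomial : ∀ {a b} → u ≤ a → v ≤ b → (F ⊛ G) a b ≡ F (a ∸ u) (b ∸ v)
    ⊛-monomial {a} {b} u≤a v≤b = begin
      (F ⊛ G) a b                                                       ≡⟨ ⊛-∑ F G a b ⟩
      ∑[ i < suc a ] ∑[ j < suc b ] (F i j * G (a ∸ i) (b ∸ j))          ≡⟨ ∑-single (suc a) (a ∸ u) (s≤s (ℕ.m∸n≤m a u)) off-row ⟩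
      ∑[ j < suc b ] (F (a ∸ u) j * G (a ∸ (a ∸ u)) (b ∸ j))            ≡⟨ ∑-single (suc b) (b ∸ v) (s≤s (ℕ.m∸n≤m b v)) off-column ⟩
      F (a ∸ u) (b ∸ v) * G (a ∸ (a ∸ u)) (b ∸ (b ∸ v))
        ≡⟨ cong₂ (λ x y → F (a ∸ u) (b ∸ v) * G x y) (ℕ.m∸[m∸n]≡n u≤a) (ℕ.m∸[m∸n]≡n v≤b) ⟩
      F (a ∸ u) (b ∸ v) * G u v                                         ≡⟨ cong (F (a ∸ u) (b ∸ v) *_) coeff-at ⟩
      F (a ∸ u) (b ∸ v) * 1ℚ                                            ≡⟨ ℚ.*-identityʳ _ ⟩
      F (a ∸ u) (b ∸ v)                                                 ∎
      where
      off-row : ∀ i → i < suc a → i ≢ a ∸ u → ∑[ j < suc b ] (F i j * G (a ∸ i) (b ∸ j)) ≡ 0ℚ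
      off-row i (s≤s i≤a) i≢ = ∑-zero (suc b) λ j _ →
        trans (cong (F i j *_) (coeff-offˣ (a ∸ i) (b ∸ j) (i≢ ∘ ∸-inverse i≤a))) (ℚ.*-zeroʳ (F i j))
      off-column : ∀ j → j < suc b → j ≢ b ∸ v → F (a ∸ u) j * G (a ∸ (a ∸ u)) (b ∸ j) ≡ 0ℚ
      off-column j (s≤s j≤b) j≢ =
        trans (cong (F (a ∸ u) j *_) (coeff-offʸ (a ∸ (a ∸ u)) (b ∸ j) (j≢ ∘ ∸-inverse j≤b))) (ℚ.*-zeroʳ (F (a ∸ u) j))

    ⊛-monomialˣ : ∀ {a b} → a < u → (F ⊛ G) a b ≡ 0ℚ
    ⊛-monomialˣ {a} {b} a<u = trans (⊛-∑ F G a b) (∑-zero (suc a) λ i _ → ∑-zero (suc b) λ j _ →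
      trans (cong (F i j *_) (coeff-offˣ (a ∸ i) (b ∸ j) λ a∸i≡u → ℕ.<⇒≱ a<u (subst (_≤ a) a∸i≡u (ℕ.m∸n≤m a i)))) (ℚ.*-zeroʳ (F i j)))

    ⊛-monomialʸ : ∀ {a b} → b < v → (F ⊛ G) a b ≡ 0ℚ
    ⊛-monomialʸ {a} {b} b<v = trans (⊛-∑ F G a b) (∑-zero (suc a) λ i _ → ∑-zero (suc b) λ j _ →
      trans (cong (F i j *_) (coeff-offʸ (a ∸ i) (b ∸ j) λ b∸j≡v → ℕ.<⇒≱ b<v (subst (_≤ b) b∸j≡v (ℕ.m∸n≤m b j)))) (ℚ.*-zeroʳ (F i j)))

  oneS-monomial : Monomial 0 0 oneS
  oneS-monomial = record
    { coeff-at = refl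
    ; coeff-offˣ = λ { zero _ 0≢0 → contradiction refl 0≢0 ; (suc a) _ _ → refl }
    ; coeff-offʸ = λ { zero zero 0≢0 → contradiction refl 0≢0 ; zero (suc b) _ → refl ; (suc a) _ _ → refl }
    }

  xS-monomial : Monomial 1 0 xS
  xS-monomial = record
    { coeff-at = refl
    ; coeff-offˣ = λ { zero _ _ → refl ; (suc zero) _ 1≢1 → contradiction refl 1≢1 ; (suc (suc a)) _ _ → refl }
    ; coeff-offʸ = λ { zero _ _ → refl ; (suc zero) zero 0≢0 → contradiction refl 0≢0 ; (suc zero) (suc b) _ → refl ; (suc (suc a)) _ _ → refl }
    }

  yS-monomial : Monomial 0 1 yS
  yS-monomial = record
    { coeff-at = refl
    ; coeff-offˣ = λ { zero _ 0≢0 → contradiction refl 0≢0 ; (suc a) _ _ → refl }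
    ; coeff-offʸ = λ { zero zero _ → refl ; zero (suc zero) 1≢1 → contradiction refl 1≢1 ; zero (suc (suc b)) _ → refl ; (suc a) _ _ → refl }
    }

  xy-monomial : Monomial 1 1 (xS ⊛ yS)
  xy-monomial = record
    { coeff-at = ⊛-monomial yS-monomial xS {1} {1} z≤n (s≤s z≤n)
    ; coeff-offˣ = λ { a zero _ → ⊛-monomialʸ yS-monomial xS {a} (s≤s z≤n)
                     ; a (suc b) a≢1 → trans (⊛-monomial yS-monomial xS {a} {suc b} z≤n (s≤s z≤n)) (Monomial.coeff-offˣ xS-monomial a b a≢1) }
    ; coeff-offʸ = λ { a zero _ → ⊛-monomialʸ yS-monomial xS {a} (s≤s z≤n)
                     ; a (suc b) 1+b≢1 → trans (⊛-monomial yS-monomial xS {a} {suc b} z≤n (s≤s z≤n))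
                                              (Monomial.coeff-offʸ xS-monomial a b (1+b≢1 ∘ cong suc)) }
    }

  ⊛-denom : ∀ F a b → (F ⊛ denom) a b ≡ (F ⊛ oneS) a b - (F ⊛ xS) a b - (F ⊛ yS) a b + (F ⊛ (xS ⊛ yS)) a b
  ⊛-denom F a b = trans (⊛-⊕ʳ F ((oneS ⊖ xS) ⊖ yS) (xS ⊛ yS) a b)
                        (cong (_+ (F ⊛ (xS ⊛ yS)) a b) (trans (⊛-⊖ʳ F (oneS ⊖ xS) yS a b) (cong (_- (F ⊛ yS) a b) (⊛-⊖ʳ F oneS xS a b))))

  -- The coefficients of e^(x+y) I₀(2√(xy))

  C-factorial : ∀ {n k} → k ≤ n → (n C k) ℕ.* (k ! ℕ.* (n ∸ k) !) ≡ n !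
  C-factorial {n} {k} k≤n = trans (cong (ℕ._* (k ! ℕ.* (n ∸ k) !)) (nCk≡n!/k![n-k]! k≤n)) (m/n*n≡m {{k !* (n ∸ k) !≢0}} (k![n∸k]!∣n! k≤n))

  vandermonde : ∀ p q c → ∑[ i < suc c ] ℕtoℚ ((p C i) ℕ.* (q C (c ∸ i))) ≡ ℕtoℚ ((p ℕ.+ q) C c)
  vandermonde zero    q c = trans (cong₂ _+_ (cong ℕtoℚ (ℕ.+-identityʳ (q C c))) (∑-zero c (λ _ _ → refl))) (ℚ.+-identityʳ _)
  vandermonde (suc p) q c = begin
    ℕtoℚ (1 ℕ.* (q C c)) + ∑[ i < c ] ℕtoℚ ((suc p C suc i) ℕ.* (q C (c ∸ suc i)))
      ≡⟨ cong (_+_ (ℕtoℚ (1 ℕ.* (q C c)))) (trans (∑-cong c λ i _ → pascal-term i) (∑-+ c _ _)) ⟩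
    ℕtoℚ (1 ℕ.* (q C c)) + (∑[ i < c ] ℕtoℚ ((p C i) ℕ.* (q C (c ∸ suc i))) + ∑[ i < c ] ℕtoℚ ((p C suc i) ℕ.* (q C (c ∸ suc i))))
      ≡⟨ solve 3 (λ x y z → x :+ (y :+ z) := y :+ (x :+ z)) refl (ℕtoℚ (1 ℕ.* (q C c))) S₁ S₂ ⟩
    ∑[ i < c ] ℕtoℚ ((p C i) ℕ.* (q C (c ∸ suc i))) + ∑[ i < suc c ] ℕtoℚ ((p C i) ℕ.* (q C (c ∸ i)))
      ≡⟨ cong₂ _+_ (shifted c) (vandermonde p q c) ⟩
    ℕtoℚ (lower c) + ℕtoℚ ((p ℕ.+ q) C c)
      ≡⟨ ℕtoℚ-+ (lower c) _ ⟨
    ℕtoℚ (lower c ℕ.+ (p ℕ.+ q) C c)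
      ≡⟨ cong ℕtoℚ (pascal c) ⟩
    ℕtoℚ ((suc p ℕ.+ q) C c) ∎
    where
    open +-*-Solver
    S₁ = ∑[ i < c ] ℕtoℚ ((p C i) ℕ.* (q C (c ∸ suc i)))
    S₂ = ∑[ i < c ] ℕtoℚ ((p C suc i) ℕ.* (q C (c ∸ suc i)))
    pascal-term : ∀ i → ℕtoℚ ((suc p C suc i) ℕ.* (q C (c ∸ suc i))) ≡
                        ℕtoℚ ((p C i) ℕ.* (q C (c ∸ suc i))) + ℕtoℚ ((p C suc i) ℕ.* (q C (c ∸ suc i)))
    pascal-term i = begin
      ℕtoℚ ((suc p C suc i) ℕ.* y)                  ≡⟨ cong (λ x → ℕtoℚ (x ℕ.* y)) (nCk+nC[k+1]≡[n+1]C[k+1] p i) ⟨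
      ℕtoℚ (((p C i) ℕ.+ (p C suc i)) ℕ.* y)        ≡⟨ cong ℕtoℚ (ℕ.*-distribʳ-+ y (p C i) (p C suc i)) ⟩
      ℕtoℚ ((p C i) ℕ.* y ℕ.+ (p C suc i) ℕ.* y)    ≡⟨ ℕtoℚ-+ ((p C i) ℕ.* y) ((p C suc i) ℕ.* y) ⟩
      ℕtoℚ ((p C i) ℕ.* y) + ℕtoℚ ((p C suc i) ℕ.* y) ∎
      where y = q C (c ∸ suc i)
    lower : ℕ → ℕ
    lower zero    = 0
    lower (suc c) = (p ℕ.+ q) C c
    shifted : ∀ c → ∑[ i < c ] ℕtoℚ ((p C i) ℕ.* (q C (c ∸ suc i))) ≡ ℕtoℚ (lower c)
    shifted zero    = refl
    shifted (suc c) = vandermonde p q c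
    pascal : ∀ c → lower c ℕ.+ (p ℕ.+ q) C c ≡ (suc p ℕ.+ q) C c
    pascal zero    = refl
    pascal (suc c) = nCk+nC[k+1]≡[n+1]C[k+1] (p ℕ.+ q) c

  I0-diagonal : ∀ d → I0 d d ≡ ((ℤ.+ 1) / (d ! ℕ.* d !)) {{d !* d !≢0}}
  I0-diagonal d rewrite dec-true (d ≟ d) refl = refl

  I0-off-diagonal : ∀ {d e} → d ≢ e → I0 d e ≡ 0ℚ
  I0-off-diagonal {d} {e} d≢e rewrite dec-false (d ≟ e) d≢e = refl

  1/-*-cancelˡ : ∀ x z .{{_ : NonZero x}} → (ℤ.+ 1) / x * ℕtoℚ (x ℕ.* z) ≡ ℕtoℚ z
  1/-*-cancelˡ x z = begin
    x⁻¹ * ℕtoℚ (x ℕ.* z)        ≡⟨ cong (x⁻¹ *_) (ℕtoℚ-* x z) ⟩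
    x⁻¹ * (ℕtoℚ x * ℕtoℚ z)     ≡⟨ ℚ.*-assoc x⁻¹ (ℕtoℚ x) (ℕtoℚ z) ⟨
    x⁻¹ * ℕtoℚ x * ℕtoℚ z       ≡⟨ cong (_* ℕtoℚ z) (/-*-cancel 1 x) ⟩
    1ℚ * ℕtoℚ z                 ≡⟨ ℚ.*-identityˡ (ℕtoℚ z) ⟩
    ℕtoℚ z                      ∎
    where x⁻¹ = (ℤ.+ 1) / x

  factorials-split : ∀ {a b i} → i ≤ a → a ∸ i ≤ b →
                     a ! ℕ.* b ! ≡ i ! ℕ.* (b ∸ (a ∸ i)) ! ℕ.* ((a ∸ i) ! ℕ.* (a ∸ i) ! ℕ.* ((a C i) ℕ.* (b C (a ∸ i))))
  factorials-split {a} {b} {i} i≤a d≤b = begin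
    a ! ℕ.* b !                                             ≡⟨ cong₂ ℕ._*_ (C-factorial i≤a) (C-factorial d≤b) ⟨
    (a C i) ℕ.* (i ! ℕ.* d !) ℕ.* ((b C d) ℕ.* (d ! ℕ.* j !))
      ≡⟨ solve 6 (λ cₐ c_b i! d! d!′ j! → cₐ :* (i! :* d!) :* (c_b :* (d!′ :* j!)) := i! :* j! :* (d! :* d!′ :* (cₐ :* c_b)))
                                                                     refl (a C i) (b C d) (i !) (d !) (d !) (j !) ⟩
    i ! ℕ.* j ! ℕ.* (d ! ℕ.* d ! ℕ.* ((a C i) ℕ.* (b C d)))  ∎
    where
    open ℕ-Solver
    d = a ∸ i
    j = b ∸ d

  expXY-I0-term : ∀ {a b i} → i ≤ a → a ∸ i ≤ b →
                  expXY i (b ∸ (a ∸ i)) * I0 (a ∸ i) (a ∸ i) * ℕtoℚ (a ! ℕ.* b !) ≡ ℕtoℚ ((a C i) ℕ.* (b C (a ∸ i)))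
  expXY-I0-term {a} {b} {i} i≤a d≤b = begin
    expXY i j * I0 d d * ℕtoℚ (a ! ℕ.* b !)   ≡⟨ cong₂ (λ y z → expXY i j * y * ℕtoℚ z) (I0-diagonal d) (factorials-split i≤a d≤b) ⟩
    X⁻¹ * Y⁻¹ * ℕtoℚ (X ℕ.* (Y ℕ.* Z))        ≡⟨ solve 3 (λ x y n → x :* y :* n := y :* (x :* n)) refl X⁻¹ Y⁻¹ (ℕtoℚ (X ℕ.* (Y ℕ.* Z))) ⟩
    Y⁻¹ * (X⁻¹ * ℕtoℚ (X ℕ.* (Y ℕ.* Z)))      ≡⟨ cong (Y⁻¹ *_) (1/-*-cancelˡ X (Y ℕ.* Z) {{i !* j !≢0}}) ⟩
    Y⁻¹ * ℕtoℚ (Y ℕ.* Z)                      ≡⟨ 1/-*-cancelˡ Y Z {{d !* d !≢0}} ⟩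
    ℕtoℚ Z                                    ∎
    where
    open +-*-Solver
    d = a ∸ i
    j = b ∸ d
    X = i ! ℕ.* j !
    Y = d ! ℕ.* d !
    Z = (a C i) ℕ.* (b C d)
    X⁻¹ = ((ℤ.+ 1) / X) {{i !* j !≢0}}
    Y⁻¹ = ((ℤ.+ 1) / Y) {{d !* d !≢0}}

  expXY⊛I0-scaled : ∀ a b → (expXY ⊛ I0) a b * ℕtoℚ (a ! ℕ.* b !) ≡ ℕtoℚ ((a ℕ.+ b) C a)
  expXY⊛I0-scaled a b = begin
    (expXY ⊛ I0) a b * s                                                    ≡⟨ cong (_* s) (⊛-∑ expXY I0 a b) ⟩
    (∑[ i < suc a ] ∑< (suc b) (term i)) * s                                ≡⟨ ∑-*ʳ (suc a) (λ i → ∑< (suc b) (term i)) s ⟨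
    ∑[ i < suc a ] (∑< (suc b) (term i) * s)                                ≡⟨ ∑-cong (suc a) (λ i i<1+a → row i (ℕ.s≤s⁻¹ i<1+a)) ⟩
    ∑[ i < suc a ] ℕtoℚ ((a C i) ℕ.* (b C (a ∸ i)))                         ≡⟨ vandermonde a b a ⟩
    ℕtoℚ ((a ℕ.+ b) C a)                                                    ∎
    where
    s = ℕtoℚ (a ! ℕ.* b !)
    term : ℕ → ℕ → ℚ
    term i j = expXY i j * I0 (a ∸ i) (b ∸ j)
    row : ∀ i → i ≤ a → ∑< (suc b) (term i) * s ≡ ℕtoℚ ((a C i) ℕ.* (b C (a ∸ i)))
    row i i≤a with a ∸ i ≤? b
    ... | yes d≤b = begin
      ∑< (suc b) (term i) * s                        ≡⟨ cong (_* s) (∑-single (suc b) (b ∸ (a ∸ i)) (s≤s (ℕ.m∸n≤m b (a ∸ i))) off) ⟩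
      term i (b ∸ (a ∸ i)) * s                       ≡⟨ cong (λ x → expXY i (b ∸ (a ∸ i)) * I0 (a ∸ i) x * s) (ℕ.m∸[m∸n]≡n d≤b) ⟩
      expXY i (b ∸ (a ∸ i)) * I0 (a ∸ i) (a ∸ i) * s ≡⟨ expXY-I0-term i≤a d≤b ⟩
      ℕtoℚ ((a C i) ℕ.* (b C (a ∸ i)))               ∎
      where
      off : ∀ j → j < suc b → j ≢ b ∸ (a ∸ i) → term i j ≡ 0ℚ
      off j (s≤s j≤b) j≢ =
        trans (cong (expXY i j *_) (I0-off-diagonal {a ∸ i} λ d≡b∸j → j≢ (∸-inverse j≤b (sym d≡b∸j)))) (ℚ.*-zeroʳ (expXY i j))
    ... | no  d≰b = begin
      ∑< (suc b) (term i) * s                        ≡⟨ cong (_* s) (∑-zero (suc b) off) ⟩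
      0ℚ * s                                         ≡⟨ ℚ.*-zeroˡ s ⟩
      0ℚ                                             ≡⟨ cong ℕtoℚ (ℕ.*-zeroʳ (a C i)) ⟨
      ℕtoℚ ((a C i) ℕ.* 0)                           ≡⟨ cong (λ c → ℕtoℚ ((a C i) ℕ.* c)) (k>n⇒nCk≡0 (ℕ.≰⇒> d≰b)) ⟨
      ℕtoℚ ((a C i) ℕ.* (b C (a ∸ i)))               ∎
      where
      off : ∀ j → j < suc b → term i j ≡ 0ℚ
      off j _ =
        trans (cong (expXY i j *_) (I0-off-diagonal {a ∸ i} λ d≡b∸j → d≰b (subst (_≤ b) (sym d≡b∸j) (ℕ.m∸n≤m b j)))) (ℚ.*-zeroʳ (expXY i j))

  -- Coefficientwise proof of the identity

  module _ (a b : ℕ) where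
    open ℕ-Solver

    factorials-suc-suc : suc a ! ℕ.* suc b ! ≡ a ! ℕ.* b ! ℕ.* (suc a ℕ.* suc b)
    factorials-suc-suc = solve 4 (λ x y fx fy → x :* fx :* (y :* fy) := fx :* fy :* (x :* y)) refl (suc a) (suc b) (a !) (b !)

    factorials-sucˡ : suc a ! ℕ.* b ! ≡ a ! ℕ.* b ! ℕ.* suc a
    factorials-sucˡ = solve 3 (λ x fx fy → x :* fx :* fy := fx :* fy :* x) refl (suc a) (a !) (b !)

    factorials-sucʳ : a ! ℕ.* suc b ! ≡ a ! ℕ.* b ! ℕ.* suc b
    factorials-sucʳ = solve 3 (λ y fx fy → fx :* (y :* fy) := fx :* fy :* y) refl (suc b) (a !) (b !)

  𝒦-scaled : ∀ a b → 𝒦 a b * ℕtoℚ (a ! ℕ.* b !) ≡ ℕtoℚ (K a b)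
  𝒦-scaled a b = /-*-cancel (K a b) (a ! ℕ.* b !) {{a !* b !≢0}}

  𝒦-scaled-by : ∀ a b t {N} → N ≡ a ! ℕ.* b ! ℕ.* t → 𝒦 a b * ℕtoℚ N ≡ ℕtoℚ (K a b ℕ.* t)
  𝒦-scaled-by a b t refl = begin
    𝒦 a b * ℕtoℚ (a ! ℕ.* b ! ℕ.* t)         ≡⟨ cong (𝒦 a b *_) (ℕtoℚ-* (a ! ℕ.* b !) t) ⟩
    𝒦 a b * (ℕtoℚ (a ! ℕ.* b !) * ℕtoℚ t)    ≡⟨ ℚ.*-assoc (𝒦 a b) (ℕtoℚ (a ! ℕ.* b !)) (ℕtoℚ t) ⟨
    𝒦 a b * ℕtoℚ (a ! ℕ.* b !) * ℕtoℚ t      ≡⟨ cong (_* ℕtoℚ t) (𝒦-scaled a b) ⟩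
    ℕtoℚ (K a b) * ℕtoℚ t                    ≡⟨ ℕtoℚ-* (K a b) t ⟨
    ℕtoℚ (K a b ℕ.* t)                       ∎

  𝒦-≡ : ∀ a b a′ b′ t → a ! ℕ.* b ! ≡ a′ ! ℕ.* b′ ! ℕ.* t → K a b ≡ K a′ b′ ℕ.* t → 𝒦 a b ≡ 𝒦 a′ b′
  𝒦-≡ a b a′ b′ t N≡ K≡ = *-cancelʳ-ℕtoℚ (a ! ℕ.* b !) {{a !* b !≢0}} (begin
    𝒦 a b * ℕtoℚ (a ! ℕ.* b !)    ≡⟨ 𝒦-scaled a b ⟩
    ℕtoℚ (K a b)                  ≡⟨ cong ℕtoℚ K≡ ⟩
    ℕtoℚ (K a′ b′ ℕ.* t)          ≡⟨ 𝒦-scaled-by a′ b′ t N≡ ⟨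
    𝒦 a′ b′ * ℕtoℚ (a ! ℕ.* b !)  ∎)

  L-scaled : ∀ {L} → IsL L → ∀ a b → L (suc a) (suc b) * ℕtoℚ (suc a ! ℕ.* suc b !) ≡ ℕtoℚ ((a ℕ.+ b) C a)
  L-scaled {L} (∂x∂yL≈ , _ , _) a b = begin
    L A B * ℕtoℚ (A ! ℕ.* B !)                      ≡⟨ cong (λ n → L A B * ℕtoℚ n) (factorials-suc-suc a b) ⟩
    L A B * ℕtoℚ (a ! ℕ.* b ! ℕ.* (A ℕ.* B))
      ≡⟨ cong (L A B *_) (trans (ℕtoℚ-* (a ! ℕ.* b !) (A ℕ.* B)) (cong (ℕtoℚ (a ! ℕ.* b !) *_) (ℕtoℚ-* A B))) ⟩
    L A B * (ℕtoℚ (a ! ℕ.* b !) * (ℕtoℚ A * ℕtoℚ B))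
      ≡⟨ solve 4 (λ l f x y → l :* (f :* (x :* y)) := x :* (y :* l) :* f) refl (L A B) (ℕtoℚ (a ! ℕ.* b !)) (ℕtoℚ A) (ℕtoℚ B) ⟩
    ∂x (∂y L) a b * ℕtoℚ (a ! ℕ.* b !)              ≡⟨ cong (_* ℕtoℚ (a ! ℕ.* b !)) (∂x∂yL≈ a b) ⟩
    (expXY ⊛ I0) a b * ℕtoℚ (a ! ℕ.* b !)           ≡⟨ expXY⊛I0-scaled a b ⟩
    ℕtoℚ ((a ℕ.+ b) C a)                            ∎
    where
    open +-*-Solver
    A = suc a
    B = suc b

  mixed-difference-* : ∀ p q r s n → (p - q - r + s) * n ≡ p * n - q * n - r * n + s * n
  mixed-difference-* = solve 5 (λ p q r s n → (p :- q :- r :+ s) :* n := p :* n :- q :* n :- r :* n :+ s :* n) refl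
    where open +-*-Solver

  mixed-difference : ∀ x y z w v → x + w ≡ y + z + v → x - y - z + w ≡ v
  mixed-difference x y z w v x+w≡y+z+v = begin
    x - y - z + w      ≡⟨ solve 4 (λ x y z w → x :- y :- z :+ w := x :+ w :- y :- z) refl x y z w ⟩
    x + w - y - z      ≡⟨ cong (λ s → s - y - z) x+w≡y+z+v ⟩
    y + z + v - y - z  ≡⟨ solve 3 (λ y z v → y :+ z :+ v :- y :- z := v) refl y z v ⟩
    v                  ∎
    where open +-*-Solver

  𝒦⊛denom-suc-suc : ∀ a b → (𝒦 ⊛ denom) (suc a) (suc b) ≡ 𝒦 (suc a) (suc b) - 𝒦 a (suc b) - 𝒦 (suc a) b + 𝒦 a b
  𝒦⊛denom-suc-suc a b = trans (⊛-denom 𝒦 (suc a) (suc b))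
    (cong₂ _+_ (cong₂ _-_ (cong₂ _-_ (⊛-monomial oneS-monomial 𝒦 {suc a} {suc b} z≤n z≤n) (⊛-monomial xS-monomial 𝒦 {suc a} {suc b} (s≤s z≤n) z≤n))
                          (⊛-monomial yS-monomial 𝒦 {suc a} {suc b} z≤n (s≤s z≤n)))
               (⊛-monomial xy-monomial 𝒦 {suc a} {suc b} (s≤s z≤n) (s≤s z≤n)))

  coefficient-suc-suc : ∀ {L} → IsL L → ∀ a b → (𝒦 ⊛ denom) (suc a) (suc b) ≡ L (suc a) (suc b) + 0ℚ
  coefficient-suc-suc {L} isL a b = *-cancelʳ-ℕtoℚ N {{A !* B !≢0}} (begin
    (𝒦 ⊛ denom) A B * ℕtoℚ N
      ≡⟨ cong (_* ℕtoℚ N) (𝒦⊛denom-suc-suc a b) ⟩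
    (𝒦 A B - 𝒦 a B - 𝒦 A b + 𝒦 a b) * ℕtoℚ N
      ≡⟨ mixed-difference-* (𝒦 A B) (𝒦 a B) (𝒦 A b) (𝒦 a b) (ℕtoℚ N) ⟩
    𝒦 A B * ℕtoℚ N - 𝒦 a B * ℕtoℚ N - 𝒦 A b * ℕtoℚ N + 𝒦 a b * ℕtoℚ N
      ≡⟨ cong₂ _+_ (cong₂ _-_ (cong₂ _-_ (𝒦-scaled A B) (𝒦-scaled-by a B A (factorials-sucˡ a B)))
                              (𝒦-scaled-by A b B (factorials-sucʳ A b)))
                   (𝒦-scaled-by a b (A ℕ.* B) (factorials-suc-suc a b)) ⟩
    ℕtoℚ (K A B) - ℕtoℚ (K a B ℕ.* A) - ℕtoℚ (K A b ℕ.* B) + ℕtoℚ (K a b ℕ.* (A ℕ.* B))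
      ≡⟨ mixed-difference (ℕtoℚ (K A B)) (ℕtoℚ (K a B ℕ.* A)) (ℕtoℚ (K A b ℕ.* B)) (ℕtoℚ (K a b ℕ.* (A ℕ.* B))) (ℕtoℚ V) recurrence ⟩
    ℕtoℚ V
      ≡⟨ L-scaled {L} isL a b ⟨
    L A B * ℕtoℚ N
      ≡⟨ cong (_* ℕtoℚ N) (ℚ.+-identityʳ (L A B)) ⟨
    (L A B + 0ℚ) * ℕtoℚ N ∎)
    where
    A = suc a
    B = suc b
    N = A ! ℕ.* B !
    V = (a ℕ.+ b) C a
    recurrence : ℕtoℚ (K A B) + ℕtoℚ (K a b ℕ.* (A ℕ.* B)) ≡ ℕtoℚ (K a B ℕ.* A) + ℕtoℚ (K A b ℕ.* B) + ℕtoℚ V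
    recurrence = begin
      ℕtoℚ (K A B) + ℕtoℚ (K a b ℕ.* (A ℕ.* B))            ≡⟨ ℕtoℚ-+ (K A B) (K a b ℕ.* (A ℕ.* B)) ⟨
      ℕtoℚ (K A B ℕ.+ K a b ℕ.* (A ℕ.* B))                 ≡⟨ cong ℕtoℚ (K-suc-suc a b) ⟩
      ℕtoℚ (K a B ℕ.* A ℕ.+ K A b ℕ.* B ℕ.+ V)             ≡⟨ ℕtoℚ-+ (K a B ℕ.* A ℕ.+ K A b ℕ.* B) V ⟩
      ℕtoℚ (K a B ℕ.* A ℕ.+ K A b ℕ.* B) + ℕtoℚ V          ≡⟨ cong (_+ ℕtoℚ V) (ℕtoℚ-+ (K a B ℕ.* A) (K A b ℕ.* B)) ⟩
      ℕtoℚ (K a B ℕ.* A) + ℕtoℚ (K A b ℕ.* B) + ℕtoℚ V     ∎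

  coefficient-zero-suc : ∀ {L} → IsL L → ∀ b → (𝒦 ⊛ denom) 0 (suc b) ≡ L 0 (suc b) + 0ℚ
  coefficient-zero-suc {L} (_ , _ , L0b≡0) b = begin
    (𝒦 ⊛ denom) 0 (suc b)
      ≡⟨ ⊛-denom 𝒦 0 (suc b) ⟩
    (𝒦 ⊛ oneS) 0 (suc b) - (𝒦 ⊛ xS) 0 (suc b) - (𝒦 ⊛ yS) 0 (suc b) + (𝒦 ⊛ (xS ⊛ yS)) 0 (suc b)
      ≡⟨ cong₂ _+_ (cong₂ _-_ (cong₂ _-_ (⊛-monomial oneS-monomial 𝒦 {0} {suc b} z≤n z≤n) (⊛-monomialˣ xS-monomial 𝒦 {0} {suc b} (s≤s z≤n)))
                              (⊛-monomial yS-monomial 𝒦 {0} {suc b} z≤n (s≤s z≤n)))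
                   (⊛-monomialˣ xy-monomial 𝒦 {0} {suc b} (s≤s z≤n)) ⟩
    𝒦 0 (suc b) - 0ℚ - 𝒦 0 b + 0ℚ
      ≡⟨ cong (λ x → x - 0ℚ - 𝒦 0 b + 0ℚ) (𝒦-≡ 0 (suc b) 0 b (suc b) (factorials-sucʳ 0 b) (trans (K-zero-suc b) (ℕ.*-comm (suc b) (K 0 b)))) ⟩
    𝒦 0 b - 0ℚ - 𝒦 0 b + 0ℚ
      ≡⟨ solve 1 (λ x → x :- con 0ℚ :- x :+ con 0ℚ := con 0ℚ :+ con 0ℚ) refl (𝒦 0 b) ⟩
    0ℚ + 0ℚ
      ≡⟨ cong (_+ 0ℚ) (L0b≡0 (suc b)) ⟨
    L 0 (suc b) + 0ℚ ∎
    where open +-*-Solver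

  coefficient-suc-zero : ∀ {L} → IsL L → ∀ a → (𝒦 ⊛ denom) (suc a) 0 ≡ L (suc a) 0 + 0ℚ
  coefficient-suc-zero {L} (_ , La0≡0 , _) a = begin
    (𝒦 ⊛ denom) (suc a) 0
      ≡⟨ ⊛-denom 𝒦 (suc a) 0 ⟩
    (𝒦 ⊛ oneS) (suc a) 0 - (𝒦 ⊛ xS) (suc a) 0 - (𝒦 ⊛ yS) (suc a) 0 + (𝒦 ⊛ (xS ⊛ yS)) (suc a) 0
      ≡⟨ cong₂ _+_ (cong₂ _-_ (cong₂ _-_ (⊛-monomial oneS-monomial 𝒦 {suc a} {0} z≤n z≤n) (⊛-monomial xS-monomial 𝒦 {suc a} {0} (s≤s z≤n) z≤n))
                              (⊛-monomialʸ yS-monomial 𝒦 {suc a} {0} (s≤s z≤n)))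
                   (⊛-monomialʸ xy-monomial 𝒦 {suc a} {0} (s≤s z≤n)) ⟩
    𝒦 (suc a) 0 - 𝒦 a 0 - 0ℚ + 0ℚ
      ≡⟨ cong (λ x → x - 𝒦 a 0 - 0ℚ + 0ℚ) (𝒦-≡ (suc a) 0 a 0 (suc a) (factorials-sucˡ a 0) (trans (K-suc-zero a) (ℕ.*-comm (suc a) (K a 0)))) ⟩
    𝒦 a 0 - 𝒦 a 0 - 0ℚ + 0ℚ
      ≡⟨ solve 1 (λ x → x :- x :- con 0ℚ :+ con 0ℚ := con 0ℚ :+ con 0ℚ) refl (𝒦 a 0) ⟩
    0ℚ + 0ℚ
      ≡⟨ cong (_+ 0ℚ) (La0≡0 (suc a)) ⟨
    L (suc a) 0 + 0ℚ ∎
    where open +-*-Solver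

  coefficient-zero-zero : ∀ {L} → IsL L → (𝒦 ⊛ denom) 0 0 ≡ L 0 0 + 1ℚ
  coefficient-zero-zero {L} (_ , La0≡0 , _) = begin
    (𝒦 ⊛ denom) 0 0
      ≡⟨ ⊛-denom 𝒦 0 0 ⟩
    (𝒦 ⊛ oneS) 0 0 - (𝒦 ⊛ xS) 0 0 - (𝒦 ⊛ yS) 0 0 + (𝒦 ⊛ (xS ⊛ yS)) 0 0
      ≡⟨ cong₂ _+_ (cong₂ _-_ (cong₂ _-_ (⊛-monomial oneS-monomial 𝒦 {0} {0} z≤n z≤n) (⊛-monomialˣ xS-monomial 𝒦 {0} {0} (s≤s z≤n)))
                              (⊛-monomialʸ yS-monomial 𝒦 {0} {0} (s≤s z≤n)))
                   (⊛-monomialʸ xy-monomial 𝒦 {0} {0} (s≤s z≤n)) ⟩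
    𝒦 0 0 - 0ℚ - 0ℚ + 0ℚ
      ≡⟨⟩
    0ℚ + 1ℚ
      ≡⟨ cong (_+ 1ℚ) (La0≡0 0) ⟨
    L 0 0 + 1ℚ ∎

  𝒦⊛denom≈L+1 : ∀ {L} → IsL L → (𝒦 ⊛ denom) ≈PS (L ⊕ oneS)
  𝒦⊛denom≈L+1 {L} isL zero    zero    = coefficient-zero-zero {L} isL
  𝒦⊛denom≈L+1 {L} isL zero    (suc b) = coefficient-zero-suc {L} isL b
  𝒦⊛denom≈L+1 {L} isL (suc a) zero    = coefficient-suc-zero {L} isL a
  𝒦⊛denom≈L+1 {L} isL (suc a) (suc b) = coefficient-suc-suc {L} isL a b

  L₀ : PS
  L₀ zero    _       = 0ℚ
  L₀ (suc a) zero    = 0ℚ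
  L₀ (suc a) (suc b) = (expXY ⊛ I0) a b * ((ℤ.+ 1) / (suc a ℕ.* suc b))

  L₀-isL : IsL L₀
  L₀-isL = ∂x∂yL₀≈ , (λ { zero → refl ; (suc a) → refl }) , (λ _ → refl)
    where
    ∂x∂yL₀≈ : ∂x (∂y L₀) ≈PS (expXY ⊛ I0)
    ∂x∂yL₀≈ a b = begin
      ℕtoℚ A * (ℕtoℚ B * (X * AB⁻¹))   ≡⟨ solve 4 (λ x y u z → x :* (y :* (z :* u)) := z :* (u :* (x :* y))) refl (ℕtoℚ A) (ℕtoℚ B) AB⁻¹ X ⟩
      X * (AB⁻¹ * (ℕtoℚ A * ℕtoℚ B))   ≡⟨ cong (λ n → X * (AB⁻¹ * n)) (ℕtoℚ-* A B) ⟨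
      X * (AB⁻¹ * ℕtoℚ (A ℕ.* B))      ≡⟨ cong (X *_) (/-*-cancel 1 (A ℕ.* B)) ⟩
      X * 1ℚ                           ≡⟨ ℚ.*-identityʳ X ⟩
      X                                ∎
      where
      open +-*-Solver
      A = suc a
      B = suc b
      X = (expXY ⊛ I0) a b
      AB⁻¹ = (ℤ.+ 1) / (A ℕ.* B)

open PowerSeries using (L₀; L₀-isL; 𝒦⊛denom≈L+1)

theorem1p3 : Σ PS IsL × (∀ L → IsL L → (𝒦 ⊛ denom) ≈PS (L ⊕ oneS))
theorem1p3 = (L₀ , L₀-isL) , λ L isL → 𝒦⊛denom≈L+1 {L} isL
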